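{- (Confluence.) The reduction relation $\to$ of the $\mathcal{L}^{\mathcal S}_2$-calculus described in the context is confluent (on well-formed proof-terms): if $t\to^* u_1$ and $t\to^* u_2$, then there is $v$ with $u_1\to^* v$ and $u_2\to^* v$.
   Context: Let $\mathcal S$ be a semiring. Propositions (modulo $\alpha$-equivalence): $A ::= X \mid \mathbf 1 \mid A\multimap A\mid A\otimes A\mid \top\mid \mathbf 0\mid A\,\&\,A\mid A\oplus A\mid\, !A\mid \forall X.A$. Proof-terms (modulo $\alpha$-equivalence; $a\in\mathcal S$): $t ::= x \mid t\boxplus u\mid a\bullet t\mid a.\star\mid \delta_{\mathbf 1}(t,u)\mid \lambda x^A.t\mid t\,u\mid t\otimes u\mid \delta_\otimes(t,x^Ay^B.u)\mid\langle\rangle\mid \delta_{\mathbf 0}(t) \mid \langle t,u\rangle\mid \delta^1_\&(t,x^A.u)\mid\delta^2_\&(t,x^B.u)\mid \mathrm{inl}(t)\mid\mathrm{inr}(t)\mid\delta_\oplus(t,x^A.u,y^B.v)\mid\, !t\mid\delta_!(t,x^A.u)\mid\Lambda X.t\mid t\,A$, where $\boxplus$ is the proof-term sum and $\bullet$ scalar product; $(u/x)t$ and $(B/X)t$ denote substitutions. One-step reduction $\to$ is the closure under arbitrary proof-term contexts of: $\delta_{\mathbf 1}(a.\star,t)\to a\bullet t$; $(\lambda x^A.t)\,u\to(u/x)t$; $\delta_\otimes(u\otimes v,x^Ay^B.w)\to(u/x,v/y)w$; $\delta^i_\&(\langle t_1,t_2\rangle,x.v)\to(t_i/x)v$ ($i=1,2$);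 $\delta_\oplus(\mathrm{inl}(t),x^A.v,y^B.w)\to(t/x)v$; $\delta_\oplus(\mathrm{inr}(u),x^A.v,y^B.w)\to(u/y)w$; $\delta_!(!t,x^A.u)\to(t/x)u$; $(\Lambda X.t)\,A\to(A/X)t$; $a.\star\boxplus b.\star\to(a+b).\star$; $(\lambda x^A.t)\boxplus(\lambda x^A.u)\to\lambda x^A.(t\boxplus u)$; $\delta_\otimes(t\boxplus u,x^Ay^B.v)\to\delta_\otimes(t,x^Ay^B.v)\boxplus\delta_\otimes(u,x^Ay^B.v)$; $\langle\rangle\boxplus\langle\rangle\to\langle\rangle$; $\langle t,u\rangle\boxplus\langle v,w\rangle\to\langle t\boxplus v,u\boxplus w\rangle$; $\delta_\oplus(t\boxplus u,x^A.v,y^B.w)\to\delta_\oplus(t,x^A.v,y^B.w)\boxplus\delta_\oplus(u,x^A.v,y^B.w)$; $!t\boxplus !u\to !(t\boxplus u)$; $(\Lambda X.t)\boxplus(\Lambda X.u)\to\Lambda X.(t\boxplus u)$; $a\bullet b.\star\to(a\times b).\star$; $a\bullet\lambda x^A.t\to\lambda x^A.a\bullet t$; $\delta_\otimes(a\bullet t,x^Ay^B.v)\to a\bullet\delta_\otimes(t,x^Ay^B.v)$; $a\bullet\langle\rangle\to\langle\rangle$; $a\bullet\langle t,u\rangle\to\langle a\bullet t,a\bullet u\rangle$; $\delta_\oplus(a\bullet t,x^A.v,y^B.w)\to a\bullet\delta_\oplus(t,x^A.v,y^B.w)$; $a\bullet !t\to !(a\bullet t)$; $a\bullet\Lambda X.t\to\Lambda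 X.a\bullet t$. $\to^*$ is the reflexive-transitive closure. -}

module Defs where

open import Level using (_⊔_)
open import Data.Nat using (ℕ; zero; suc)
open import Data.Fin using (Fin; zero; suc)
open import Data.Vec using (Vec; lookup; map; _∷_)
open import Data.Product using (∃; _×_)
open import Algebra.Bundles using (Semiring)
open import Relation.Binary.Construct.Closure.ReflexiveTransitive using (Star)

-- Propositions of L^S_2 (well-scoped de Bruijn: n = number of free
-- propositional variables). Alpha-equivalence is syntactic identity.

infixr 5 _⊸_
infixr 6 _⊕_
infixr 7 _&_
infixr 8 _⊗_

data Ty (n : ℕ) : Set where
  `_   : Fin n → Ty n
  𝟏    : Ty n
  _⊸_  : Ty n → Ty n → Ty n
  _⊗_  : Ty n → Ty n → Ty n
  ⊤ₜ   : Ty n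
  𝟎    : Ty n
  _&_  : Ty n → Ty n → Ty n
  _⊕_  : Ty n → Ty n → Ty n
  !ₜ   : Ty n → Ty n
  ∀ₜ   : Ty (suc n) → Ty n

extR : ∀ {n n'} → (Fin n → Fin n') → Fin (suc n) → Fin (suc n')
extR ρ zero    = zero
extR ρ (suc i) = suc (ρ i)

renTy : ∀ {n n'} → (Fin n → Fin n') → Ty n → Ty n'
renTy ρ (` x)    = ` (ρ x)
renTy ρ 𝟏        = 𝟏
renTy ρ (A ⊸ B)  = renTy ρ A ⊸ renTy ρ B
renTy ρ (A ⊗ B)  = renTy ρ A ⊗ renTy ρ B
renTy ρ ⊤ₜ       = ⊤ₜ
renTy ρ 𝟎        = 𝟎
renTy ρ (A & B)  = renTy ρ A & renTy ρ B
renTy ρ (A ⊕ B)  = renTy ρ A ⊕ renTy ρ B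
renTy ρ (!ₜ A)   = !ₜ (renTy ρ A)
renTy ρ (∀ₜ A)   = ∀ₜ (renTy (extR ρ) A)

extsTy : ∀ {n n'} → (Fin n → Ty n') → Fin (suc n) → Ty (suc n')
extsTy σ zero    = ` zero
extsTy σ (suc i) = renTy suc (σ i)

subTy : ∀ {n n'} → (Fin n → Ty n') → Ty n → Ty n'
subTy σ (` x)    = σ x
subTy σ 𝟏        = 𝟏
subTy σ (A ⊸ B)  = subTy σ A ⊸ subTy σ B
subTy σ (A ⊗ B)  = subTy σ A ⊗ subTy σ B
subTy σ ⊤ₜ       = ⊤ₜ
subTy σ 𝟎        = 𝟎
subTy σ (A & B)  = subTy σ A & subTy σ B
subTy σ (A ⊕ B)  = subTy σ A ⊕ subTy σ B
subTy σ (!ₜ A)   = !ₜ (subTy σ A)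
subTy σ (∀ₜ A)   = ∀ₜ (subTy (extsTy σ) A)

σ₀ : ∀ {n} → Ty n → Fin (suc n) → Ty n
σ₀ B zero    = B
σ₀ B (suc i) = ` i

_[_]ₜ : ∀ {n} → Ty (suc n) → Ty n → Ty n
A [ B ]ₜ = subTy (σ₀ B) A

module Calculus {c ℓ} (𝒮 : Semiring c ℓ) where

  open Semiring 𝒮 using (Carrier; _+_; _*_)

  infixl 5 _⊞_
  infixr 6 _•_
  infixl 7 _·_
  infixl 7 _·ᵀ_

  -- Proof-terms, well-scoped: n propositional variables, m proof variables.
  -- Binder conventions:
  --   ƛ A t         : λx^A.t, x is variable 0 of t
  --   δ⊗ t A B u    : δ_⊗(t, x^A y^B. u), x is variable 1, y is variable 0 of u
  --   δ&₁ t A u     : δ^1_&(t, x^A. u);  δ&₂ t B u : δ^2_&(t, x^B. u)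
  --   δ⊕ t A v B w  : δ_⊕(t, x^A. v, y^B. w)
  --   δ! t A u      : δ_!(t, x^A. u)
  --   Λ t           : ΛX.t, X is propositional variable 0 of t
  data Tm (n m : ℕ) : Set c where
    var   : Fin m → Tm n m
    _⊞_   : Tm n m → Tm n m → Tm n m
    _•_   : Carrier → Tm n m → Tm n m
    _∙⋆   : Carrier → Tm n m
    δ𝟏    : Tm n m → Tm n m → Tm n m
    ƛ     : Ty n → Tm n (suc m) → Tm n m
    _·_   : Tm n m → Tm n m → Tm n m
    _⊗ₜ_  : Tm n m → Tm n m → Tm n m
    δ⊗    : Tm n m → Ty n → Ty n → Tm n (suc (suc m)) → Tm n m
    ⟨⟩    : Tm n m
    δ𝟎    : Tm n m → Tm n m
    ⟨_,_⟩ : Tm n m → Tm n m → Tm n m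
    δ&₁   : Tm n m → Ty n → Tm n (suc m) → Tm n m
    δ&₂   : Tm n m → Ty n → Tm n (suc m) → Tm n m
    inl   : Tm n m → Tm n m
    inr   : Tm n m → Tm n m
    δ⊕    : Tm n m → Ty n → Tm n (suc m) → Ty n → Tm n (suc m) → Tm n m
    !_    : Tm n m → Tm n m
    δ!    : Tm n m → Ty n → Tm n (suc m) → Tm n m
    Λ     : Tm (suc n) m → Tm n m
    _·ᵀ_  : Tm n m → Ty n → Tm n m

  renTm : ∀ {n m m'} → (Fin m → Fin m') → Tm n m → Tm n m'
  renTm ρ (var x)         = var (ρ x)
  renTm ρ (t ⊞ u)         = renTm ρ t ⊞ renTm ρ u
  renTm ρ (a • t)         = a • renTm ρ t
  renTm ρ (a ∙⋆)          = a ∙⋆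
  renTm ρ (δ𝟏 t u)        = δ𝟏 (renTm ρ t) (renTm ρ u)
  renTm ρ (ƛ A t)         = ƛ A (renTm (extR ρ) t)
  renTm ρ (t · u)         = renTm ρ t · renTm ρ u
  renTm ρ (t ⊗ₜ u)        = renTm ρ t ⊗ₜ renTm ρ u
  renTm ρ (δ⊗ t A B u)    = δ⊗ (renTm ρ t) A B (renTm (extR (extR ρ)) u)
  renTm ρ ⟨⟩              = ⟨⟩
  renTm ρ (δ𝟎 t)          = δ𝟎 (renTm ρ t)
  renTm ρ ⟨ t , u ⟩       = ⟨ renTm ρ t , renTm ρ u ⟩
  renTm ρ (δ&₁ t A u)     = δ&₁ (renTm ρ t) A (renTm (extR ρ) u)
  renTm ρ (δ&₂ t A u)     = δ&₂ (renTm ρ t) A (renTm (extR ρ) u)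
  renTm ρ (inl t)         = inl (renTm ρ t)
  renTm ρ (inr t)         = inr (renTm ρ t)
  renTm ρ (δ⊕ t A v B w)  = δ⊕ (renTm ρ t) A (renTm (extR ρ) v) B (renTm (extR ρ) w)
  renTm ρ (! t)           = ! (renTm ρ t)
  renTm ρ (δ! t A u)      = δ! (renTm ρ t) A (renTm (extR ρ) u)
  renTm ρ (Λ t)           = Λ (renTm ρ t)
  renTm ρ (t ·ᵀ A)        = renTm ρ t ·ᵀ A

  subTyTm : ∀ {n n' m} → (Fin n → Ty n') → Tm n m → Tm n' m
  subTyTm σ (var x)         = var x
  subTyTm σ (t ⊞ u)         = subTyTm σ t ⊞ subTyTm σ u
  subTyTm σ (a • t)         = a • subTyTm σ t
  subTyTm σ (a ∙⋆)          = a ∙⋆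
  subTyTm σ (δ𝟏 t u)        = δ𝟏 (subTyTm σ t) (subTyTm σ u)
  subTyTm σ (ƛ A t)         = ƛ (subTy σ A) (subTyTm σ t)
  subTyTm σ (t · u)         = subTyTm σ t · subTyTm σ u
  subTyTm σ (t ⊗ₜ u)        = subTyTm σ t ⊗ₜ subTyTm σ u
  subTyTm σ (δ⊗ t A B u)    = δ⊗ (subTyTm σ t) (subTy σ A) (subTy σ B) (subTyTm σ u)
  subTyTm σ ⟨⟩              = ⟨⟩
  subTyTm σ (δ𝟎 t)          = δ𝟎 (subTyTm σ t)
  subTyTm σ ⟨ t , u ⟩       = ⟨ subTyTm σ t , subTyTm σ u ⟩
  subTyTm σ (δ&₁ t A u)     = δ&₁ (subTyTm σ t) (subTy σ A) (subTyTm σ u)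
  subTyTm σ (δ&₂ t A u)     = δ&₂ (subTyTm σ t) (subTy σ A) (subTyTm σ u)
  subTyTm σ (inl t)         = inl (subTyTm σ t)
  subTyTm σ (inr t)         = inr (subTyTm σ t)
  subTyTm σ (δ⊕ t A v B w)  = δ⊕ (subTyTm σ t) (subTy σ A) (subTyTm σ v) (subTy σ B) (subTyTm σ w)
  subTyTm σ (! t)           = ! (subTyTm σ t)
  subTyTm σ (δ! t A u)      = δ! (subTyTm σ t) (subTy σ A) (subTyTm σ u)
  subTyTm σ (Λ t)           = Λ (subTyTm (extsTy σ) t)
  subTyTm σ (t ·ᵀ A)        = subTyTm σ t ·ᵀ subTy σ A

  wkTyTm : ∀ {n m} → Tm n m → Tm (suc n) m
  wkTyTm = subTyTm (λ i → ` (suc i))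

  extsTm : ∀ {n m m'} → (Fin m → Tm n m') → Fin (suc m) → Tm n (suc m')
  extsTm σ zero    = var zero
  extsTm σ (suc i) = renTm suc (σ i)

  subTm : ∀ {n m m'} → (Fin m → Tm n m') → Tm n m → Tm n m'
  subTm σ (var x)         = σ x
  subTm σ (t ⊞ u)         = subTm σ t ⊞ subTm σ u
  subTm σ (a • t)         = a • subTm σ t
  subTm σ (a ∙⋆)          = a ∙⋆
  subTm σ (δ𝟏 t u)        = δ𝟏 (subTm σ t) (subTm σ u)
  subTm σ (ƛ A t)         = ƛ A (subTm (extsTm σ) t)
  subTm σ (t · u)         = subTm σ t · subTm σ u
  subTm σ (t ⊗ₜ u)        = subTm σ t ⊗ₜ subTm σ u
  subTm σ (δ⊗ t A B u)    = δ⊗ (subTm σ t) A B (subTm (extsTm (extsTm σ)) u)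
  subTm σ ⟨⟩              = ⟨⟩
  subTm σ (δ𝟎 t)          = δ𝟎 (subTm σ t)
  subTm σ ⟨ t , u ⟩       = ⟨ subTm σ t , subTm σ u ⟩
  subTm σ (δ&₁ t A u)     = δ&₁ (subTm σ t) A (subTm (extsTm σ) u)
  subTm σ (δ&₂ t A u)     = δ&₂ (subTm σ t) A (subTm (extsTm σ) u)
  subTm σ (inl t)         = inl (subTm σ t)
  subTm σ (inr t)         = inr (subTm σ t)
  subTm σ (δ⊕ t A v B w)  = δ⊕ (subTm σ t) A (subTm (extsTm σ) v) B (subTm (extsTm σ) w)
  subTm σ (! t)           = ! (subTm σ t)
  subTm σ (δ! t A u)      = δ! (subTm σ t) A (subTm (extsTm σ) u)
  subTm σ (Λ t)           = Λ (subTm (λ i → wkTyTm (σ i)) t)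
  subTm σ (t ·ᵀ A)        = subTm σ t ·ᵀ A

  ς₁ : ∀ {n m} → Tm n m → Fin (suc m) → Tm n m
  ς₁ u zero    = u
  ς₁ u (suc i) = var i

  _[_] : ∀ {n m} → Tm n (suc m) → Tm n m → Tm n m
  t [ u ] = subTm (ς₁ u) t

  ς₂ : ∀ {n m} → Tm n m → Tm n m → Fin (suc (suc m)) → Tm n m
  ς₂ u v zero          = v
  ς₂ u v (suc zero)    = u
  ς₂ u v (suc (suc i)) = var i

  _[_,_] : ∀ {n m} → Tm n (suc (suc m)) → Tm n m → Tm n m → Tm n m
  w [ u , v ] = subTm (ς₂ u v) w

  _[_]ᵀ : ∀ {n m} → Tm (suc n) m → Ty n → Tm n m
  t [ B ]ᵀ = subTyTm (σ₀ B) t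

  infix 4 _⟶_
  data _⟶_ : ∀ {n m} → Tm n m → Tm n m → Set c where
    β𝟏   : ∀ {n m a} {t : Tm n m} → δ𝟏 (a ∙⋆) t ⟶ a • t
    β⊸   : ∀ {n m A} {t : Tm n (suc m)} {u} → ƛ A t · u ⟶ t [ u ]
    β⊗   : ∀ {n m A B} {u v : Tm n m} {w} → δ⊗ (u ⊗ₜ v) A B w ⟶ w [ u , v ]
    β&₁  : ∀ {n m A} {t₁ t₂ : Tm n m} {v} → δ&₁ ⟨ t₁ , t₂ ⟩ A v ⟶ v [ t₁ ]
    β&₂  : ∀ {n m A} {t₁ t₂ : Tm n m} {v} → δ&₂ ⟨ t₁ , t₂ ⟩ A v ⟶ v [ t₂ ]
    β⊕₁  : ∀ {n m A B} {t : Tm n m} {v w} → δ⊕ (inl t) A v B w ⟶ v [ t ]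
    β⊕₂  : ∀ {n m A B} {u : Tm n m} {v w} → δ⊕ (inr u) A v B w ⟶ w [ u ]
    β!   : ∀ {n m A} {t : Tm n m} {u} → δ! (! t) A u ⟶ u [ t ]
    β∀   : ∀ {n m A} {t : Tm (suc n) m} → Λ t ·ᵀ A ⟶ t [ A ]ᵀ
    ⊞𝟏   : ∀ {n m a b} → (a ∙⋆) ⊞ (b ∙⋆) ⟶ _∙⋆ {n} {m} (a + b)
    ⊞⊸   : ∀ {n m A} {t u : Tm n (suc m)} → ƛ A t ⊞ ƛ A u ⟶ ƛ A (t ⊞ u)
    ⊞⊗   : ∀ {n m A B} {t u : Tm n m} {v} →
           δ⊗ (t ⊞ u) A B v ⟶ δ⊗ t A B v ⊞ δ⊗ u A B v
    ⊞⊤   : ∀ {n m} → ⟨⟩ ⊞ ⟨⟩ ⟶ ⟨⟩ {n} {m}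
    ⊞&   : ∀ {n m} {t u v w : Tm n m} → ⟨ t , u ⟩ ⊞ ⟨ v , w ⟩ ⟶ ⟨ t ⊞ v , u ⊞ w ⟩
    ⊞⊕   : ∀ {n m A B} {t u : Tm n m} {v w} →
           δ⊕ (t ⊞ u) A v B w ⟶ δ⊕ t A v B w ⊞ δ⊕ u A v B w
    ⊞!   : ∀ {n m} {t u : Tm n m} → ! t ⊞ ! u ⟶ ! (t ⊞ u)
    ⊞∀   : ∀ {n m} {t u : Tm (suc n) m} → Λ t ⊞ Λ u ⟶ Λ (t ⊞ u)
    •𝟏   : ∀ {n m a b} → a • (b ∙⋆) ⟶ _∙⋆ {n} {m} (a * b)
    •⊸   : ∀ {n m a A} {t : Tm n (suc m)} → a • ƛ A t ⟶ ƛ A (a • t)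
    •⊗   : ∀ {n m a A B} {t : Tm n m} {v} → δ⊗ (a • t) A B v ⟶ a • δ⊗ t A B v
    •⊤   : ∀ {n m a} → a • ⟨⟩ ⟶ ⟨⟩ {n} {m}
    •&   : ∀ {n m a} {t u : Tm n m} → a • ⟨ t , u ⟩ ⟶ ⟨ a • t , a • u ⟩
    •⊕   : ∀ {n m a A B} {t : Tm n m} {v w} → δ⊕ (a • t) A v B w ⟶ a • δ⊕ t A v B w
    •!   : ∀ {n m a} {t : Tm n m} → a • ! t ⟶ ! (a • t)
    •∀   : ∀ {n m a} {t : Tm (suc n) m} → a • Λ t ⟶ Λ (a • t)
    ξ⊞ₗ  : ∀ {n m} {t t' u : Tm n m} → t ⟶ t' → t ⊞ u ⟶ t' ⊞ u
    ξ⊞ᵣ  : ∀ {n m} {t u u' : Tm n m} → u ⟶ u' → t ⊞ u ⟶ t ⊞ u'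
    ξ•   : ∀ {n m a} {t t' : Tm n m} → t ⟶ t' → a • t ⟶ a • t'
    ξδ𝟏ₗ : ∀ {n m} {t t' u : Tm n m} → t ⟶ t' → δ𝟏 t u ⟶ δ𝟏 t' u
    ξδ𝟏ᵣ : ∀ {n m} {t u u' : Tm n m} → u ⟶ u' → δ𝟏 t u ⟶ δ𝟏 t u'
    ξƛ   : ∀ {n m A} {t t' : Tm n (suc m)} → t ⟶ t' → ƛ A t ⟶ ƛ A t'
    ξ·ₗ  : ∀ {n m} {t t' u : Tm n m} → t ⟶ t' → t · u ⟶ t' · u
    ξ·ᵣ  : ∀ {n m} {t u u' : Tm n m} → u ⟶ u' → t · u ⟶ t · u'
    ξ⊗ₗ  : ∀ {n m} {t t' u : Tm n m} → t ⟶ t' → t ⊗ₜ u ⟶ t' ⊗ₜ u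
    ξ⊗ᵣ  : ∀ {n m} {t u u' : Tm n m} → u ⟶ u' → t ⊗ₜ u ⟶ t ⊗ₜ u'
    ξδ⊗ₗ : ∀ {n m A B} {t t' : Tm n m} {u} → t ⟶ t' → δ⊗ t A B u ⟶ δ⊗ t' A B u
    ξδ⊗ᵣ : ∀ {n m A B} {t : Tm n m} {u u'} → u ⟶ u' → δ⊗ t A B u ⟶ δ⊗ t A B u'
    ξδ𝟎  : ∀ {n m} {t t' : Tm n m} → t ⟶ t' → δ𝟎 t ⟶ δ𝟎 t'
    ξ&ₗ  : ∀ {n m} {t t' u : Tm n m} → t ⟶ t' → ⟨ t , u ⟩ ⟶ ⟨ t' , u ⟩
    ξ&ᵣ  : ∀ {n m} {t u u' : Tm n m} → u ⟶ u' → ⟨ t , u ⟩ ⟶ ⟨ t , u' ⟩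
    ξδ&₁ₗ : ∀ {n m A} {t t' : Tm n m} {u} → t ⟶ t' → δ&₁ t A u ⟶ δ&₁ t' A u
    ξδ&₁ᵣ : ∀ {n m A} {t : Tm n m} {u u'} → u ⟶ u' → δ&₁ t A u ⟶ δ&₁ t A u'
    ξδ&₂ₗ : ∀ {n m A} {t t' : Tm n m} {u} → t ⟶ t' → δ&₂ t A u ⟶ δ&₂ t' A u
    ξδ&₂ᵣ : ∀ {n m A} {t : Tm n m} {u u'} → u ⟶ u' → δ&₂ t A u ⟶ δ&₂ t A u'
    ξinl : ∀ {n m} {t t' : Tm n m} → t ⟶ t' → inl t ⟶ inl t'
    ξinr : ∀ {n m} {t t' : Tm n m} → t ⟶ t' → inr t ⟶ inr t'
    ξδ⊕₁ : ∀ {n m A B} {t t' : Tm n m} {v w} → t ⟶ t' → δ⊕ t A v B w ⟶ δ⊕ t' A v B w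
    ξδ⊕₂ : ∀ {n m A B} {t : Tm n m} {v v' w} → v ⟶ v' → δ⊕ t A v B w ⟶ δ⊕ t A v' B w
    ξδ⊕₃ : ∀ {n m A B} {t : Tm n m} {v w w'} → w ⟶ w' → δ⊕ t A v B w ⟶ δ⊕ t A v B w'
    ξ!   : ∀ {n m} {t t' : Tm n m} → t ⟶ t' → ! t ⟶ ! t'
    ξδ!ₗ : ∀ {n m A} {t t' : Tm n m} {u} → t ⟶ t' → δ! t A u ⟶ δ! t' A u
    ξδ!ᵣ : ∀ {n m A} {t : Tm n m} {u u'} → u ⟶ u' → δ! t A u ⟶ δ! t A u'
    ξΛ   : ∀ {n m} {t t' : Tm (suc n) m} → t ⟶ t' → Λ t ⟶ Λ t'
    ξ·ᵀ  : ∀ {n m A} {t t' : Tm n m} → t ⟶ t' → t ·ᵀ A ⟶ t' ·ᵀ A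

  infix 4 _⟶*_
  _⟶*_ : ∀ {n m} → Tm n m → Tm n m → Set c
  _⟶*_ = Star _⟶_

  Ctx : ℕ → ℕ → Set
  Ctx n m = Vec (Ty n) m

  infix 3 _⊢_∶_
  data _⊢_∶_ : ∀ {n m} → Ctx n m → Tm n m → Ty n → Set c where
    ⊢var  : ∀ {n m} {Γ : Ctx n m} {x} → Γ ⊢ var x ∶ lookup Γ x
    ⊢⊞    : ∀ {n m} {Γ : Ctx n m} {t u A} → Γ ⊢ t ∶ A → Γ ⊢ u ∶ A → Γ ⊢ t ⊞ u ∶ A
    ⊢•    : ∀ {n m} {Γ : Ctx n m} {a t A} → Γ ⊢ t ∶ A → Γ ⊢ a • t ∶ A
    ⊢⋆    : ∀ {n m} {Γ : Ctx n m} {a} → Γ ⊢ a ∙⋆ ∶ 𝟏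
    ⊢δ𝟏   : ∀ {n m} {Γ : Ctx n m} {t u C} → Γ ⊢ t ∶ 𝟏 → Γ ⊢ u ∶ C → Γ ⊢ δ𝟏 t u ∶ C
    ⊢ƛ    : ∀ {n m} {Γ : Ctx n m} {A B t} → (A ∷ Γ) ⊢ t ∶ B → Γ ⊢ ƛ A t ∶ A ⊸ B
    ⊢·    : ∀ {n m} {Γ : Ctx n m} {A B t u} → Γ ⊢ t ∶ A ⊸ B → Γ ⊢ u ∶ A → Γ ⊢ t · u ∶ B
    ⊢⊗    : ∀ {n m} {Γ : Ctx n m} {A B t u} → Γ ⊢ t ∶ A → Γ ⊢ u ∶ B → Γ ⊢ t ⊗ₜ u ∶ A ⊗ B
    ⊢δ⊗   : ∀ {n m} {Γ : Ctx n m} {A B C t u} → Γ ⊢ t ∶ A ⊗ B → (B ∷ A ∷ Γ) ⊢ u ∶ C →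
            Γ ⊢ δ⊗ t A B u ∶ C
    ⊢⟨⟩   : ∀ {n m} {Γ : Ctx n m} → Γ ⊢ ⟨⟩ ∶ ⊤ₜ
    ⊢δ𝟎   : ∀ {n m} {Γ : Ctx n m} {t C} → Γ ⊢ t ∶ 𝟎 → Γ ⊢ δ𝟎 t ∶ C
    ⊢⟨,⟩  : ∀ {n m} {Γ : Ctx n m} {A B t u} → Γ ⊢ t ∶ A → Γ ⊢ u ∶ B → Γ ⊢ ⟨ t , u ⟩ ∶ A & B
    ⊢δ&₁  : ∀ {n m} {Γ : Ctx n m} {A B C t u} → Γ ⊢ t ∶ A & B → (A ∷ Γ) ⊢ u ∶ C →
            Γ ⊢ δ&₁ t A u ∶ C
    ⊢δ&₂  : ∀ {n m} {Γ : Ctx n m} {A B C t u} → Γ ⊢ t ∶ A & B → (B ∷ Γ) ⊢ u ∶ C →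
            Γ ⊢ δ&₂ t B u ∶ C
    ⊢inl  : ∀ {n m} {Γ : Ctx n m} {A B t} → Γ ⊢ t ∶ A → Γ ⊢ inl t ∶ A ⊕ B
    ⊢inr  : ∀ {n m} {Γ : Ctx n m} {A B t} → Γ ⊢ t ∶ B → Γ ⊢ inr t ∶ A ⊕ B
    ⊢δ⊕   : ∀ {n m} {Γ : Ctx n m} {A B C t v w} → Γ ⊢ t ∶ A ⊕ B →
            (A ∷ Γ) ⊢ v ∶ C → (B ∷ Γ) ⊢ w ∶ C → Γ ⊢ δ⊕ t A v B w ∶ C
    ⊢!    : ∀ {n m} {Γ : Ctx n m} {A t} → Γ ⊢ t ∶ A → Γ ⊢ ! t ∶ !ₜ A
    ⊢δ!   : ∀ {n m} {Γ : Ctx n m} {A C t u} → Γ ⊢ t ∶ !ₜ A → (A ∷ Γ) ⊢ u ∶ C →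
            Γ ⊢ δ! t A u ∶ C
    ⊢Λ    : ∀ {n m} {Γ : Ctx n m} {A t} → map (renTy suc) Γ ⊢ t ∶ A → Γ ⊢ Λ t ∶ ∀ₜ A
    ⊢·ᵀ   : ∀ {n m} {Γ : Ctx n m} {A B t} → Γ ⊢ t ∶ ∀ₜ A → Γ ⊢ t ·ᵀ B ∶ A [ B ]ₜ

  Confluent : Set c
  Confluent = ∀ {n m} {Γ : Ctx n m} {A : Ty n} {t u₁ u₂ : Tm n m} →
              Γ ⊢ t ∶ A → t ⟶* u₁ → t ⟶* u₂ →
              ∃ λ v → (u₁ ⟶* v) × (u₂ ⟶* v)

{-# OPTIONS --safe #-}
module Submission where

-- Tait–Martin-Löf's method with Takahashi's complete developments. Parallel
-- reduction ⇒ contracts any set of redexes already present in a term; it contains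
-- ⟶ and is contained in ⟶*, so ⟶* and ⇒* coincide. The complete development of t
-- contracts all redexes of t at once, and on well-typed terms every parallel
-- reduct of t reduces to it in one ⇒-step (the triangle property). As ⇒ preserves
-- typing, a strip lemma turns the triangle property into confluence of ⇒*.
--
-- Typing cannot be dropped: for normal v, δ⊗(a.⋆ ⊞ b.⋆, xy.v) has the two distinct
-- normal forms δ⊗((a+b).⋆, xy.v) and δ⊗(a.⋆, xy.v) ⊞ δ⊗(b.⋆, xy.v). In a well-typed
-- term the argument of δ⊗ or δ⊕ has type A ⊗ B or A ⊕ B, which no introduction
-- absorbing ⊞ or • (those of 𝟏, ⊸, ⊤, &, !, ∀) can have, so these non-joinable
-- overlaps never arise.

open import Algebra.Bundles using (Semiring)
open import Data.Nat using (ℕ; suc)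
open import Data.Fin using (Fin; zero; suc)
open import Data.Vec using (lookup; map; _∷_)
open import Data.Vec.Properties using (lookup-map)
open import Data.Product using (∃; _×_; map₂) renaming (map to map×)
open import Function using (_∘_; id)
open import Level using (Level)
open import Relation.Binary.Core using (Rel)
open import Relation.Binary.PropositionalEquality
  using (_≡_; _≗_; refl; sym; trans; cong; cong₂; subst; module ≡-Reasoning)
open import Relation.Binary.Construct.Closure.ReflexiveTransitive
  using (Star; ε; _◅_; _◅◅_; gmap; _⋆) renaming (map to map⋆)

open import Defs

open ≡-Reasoning

private variable
  a b c d : Level
  A B C D E F : Set a

cong₃ : (h : A → B → C → D) {x x' : A} {y y' : B} {z z' : C} →
        x ≡ x' → y ≡ y' → z ≡ z' → h x y z ≡ h x' y' z'
cong₃ h refl refl refl = refl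

cong₄ : (h : A → B → C → D → E) {x x' : A} {y y' : B} {z z' : C} {w w' : D} →
        x ≡ x' → y ≡ y' → z ≡ z' → w ≡ w' → h x y z w ≡ h x' y' z' w'
cong₄ h refl refl refl refl = refl

cong₅ : (h : A → B → C → D → E → F) {x x' : A} {y y' : B} {z z' : C} {w w' : D} {v v' : E} →
        x ≡ x' → y ≡ y' → z ≡ z' → w ≡ w' → v ≡ v' → h x y z w v ≡ h x' y' z' w' v'
cong₅ h refl refl refl refl refl = refl

star-cong₂ : {R : Rel A a} {S : Rel B b} {T : Rel C c} (op : A → B → C) →
             (∀ {x x' y} → R x x' → T (op x y) (op x' y)) →
             (∀ {x y y'} → S y y' → T (op x y) (op x y')) →
             ∀ {x x' y y'} → Star R x x' → Star S y y' → Star T (op x y) (op x' y')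
star-cong₂ op stepˡ stepʳ rs ss = gmap (λ x → op x _) stepˡ rs ◅◅ gmap (op _) stepʳ ss

star-cong₃ : {R : Rel A a} {S : Rel B b} {T : Rel C c} {U : Rel D d} (op : A → B → C → D) →
             (∀ {x x' y z} → R x x' → U (op x y z) (op x' y z)) →
             (∀ {x y y' z} → S y y' → U (op x y z) (op x y' z)) →
             (∀ {x y z z'} → T z z' → U (op x y z) (op x y z')) →
             ∀ {x x' y y' z z'} → Star R x x' → Star S y y' → Star T z z' →
             Star U (op x y z) (op x' y' z')
star-cong₃ op step₁ step₂ step₃ rs ss ts =
  gmap (λ x → op x _ _) step₁ rs ◅◅ gmap (λ y → op _ y _) step₂ ss ◅◅ gmap (op _ _) step₃ ts

module TriangleConfluence
  {ℓa ℓi ℓr : Level} {A : Set ℓa} (Inv : A → Set ℓi) (_⇒_ : Rel A ℓr) (develop : A → A)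
  (⇒-preserves : ∀ {x y} → Inv x → x ⇒ y → Inv y)
  (triangle : ∀ {x y} → Inv x → x ⇒ y → y ⇒ develop x)
  where

  open import Data.Product using (_,_)

  strip : ∀ {x y z} → Inv x → x ⇒ y → Star _⇒_ x z → ∃ λ w → Star _⇒_ y w × z ⇒ w
  strip _ d ε = _ , ε , d
  strip inv d (r ◅ rs) with strip (⇒-preserves inv r) (triangle inv r) rs
  ... | w , ys , d' = w , triangle inv d ◅ ys , d'

  confluent : ∀ {x y z} → Inv x → Star _⇒_ x y → Star _⇒_ x z →
              ∃ λ w → Star _⇒_ y w × Star _⇒_ z w
  confluent _ ε zs = _ , zs , ε
  confluent inv (r ◅ rs) zs with strip inv r zs
  ... | w , ys , d with confluent (⇒-preserves inv r) rs ys
  ... | v , ys' , ws = v , ys' , d ◅ ws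

private variable
  n n' n'' : ℕ

-- Renaming and substitution in propositions

extR-extR : {ρ : Fin n' → Fin n''} {ρ' : Fin n → Fin n'} {ρ'' : Fin n → Fin n''} →
            ρ ∘ ρ' ≗ ρ'' → extR ρ ∘ extR ρ' ≗ extR ρ''
extR-extR h zero    = refl
extR-extR h (suc i) = cong suc (h i)

renTy-renTy : {ρ : Fin n' → Fin n''} {ρ' : Fin n → Fin n'} {ρ'' : Fin n → Fin n''} →
              ρ ∘ ρ' ≗ ρ'' → renTy ρ ∘ renTy ρ' ≗ renTy ρ''
renTy-renTy h (` x)   = cong `_ (h x)
renTy-renTy h 𝟏       = refl
renTy-renTy h (A ⊸ B) = cong₂ _⊸_ (renTy-renTy h A) (renTy-renTy h B)
renTy-renTy h (A ⊗ B) = cong₂ _⊗_ (renTy-renTy h A) (renTy-renTy h B)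
renTy-renTy h ⊤ₜ      = refl
renTy-renTy h 𝟎       = refl
renTy-renTy h (A & B) = cong₂ _&_ (renTy-renTy h A) (renTy-renTy h B)
renTy-renTy h (A ⊕ B) = cong₂ _⊕_ (renTy-renTy h A) (renTy-renTy h B)
renTy-renTy h (!ₜ A)  = cong !ₜ (renTy-renTy h A)
renTy-renTy h (∀ₜ A)  = cong ∀ₜ (renTy-renTy (extR-extR h) A)

extsTy-extR : {σ : Fin n' → Ty n''} {ρ : Fin n → Fin n'} {τ : Fin n → Ty n''} →
              σ ∘ ρ ≗ τ → extsTy σ ∘ extR ρ ≗ extsTy τ
extsTy-extR h zero    = refl
extsTy-extR h (suc i) = cong (renTy suc) (h i)

subTy-renTy : {σ : Fin n' → Ty n''} {ρ : Fin n → Fin n'} {τ : Fin n → Ty n''} →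
              σ ∘ ρ ≗ τ → subTy σ ∘ renTy ρ ≗ subTy τ
subTy-renTy h (` x)   = h x
subTy-renTy h 𝟏       = refl
subTy-renTy h (A ⊸ B) = cong₂ _⊸_ (subTy-renTy h A) (subTy-renTy h B)
subTy-renTy h (A ⊗ B) = cong₂ _⊗_ (subTy-renTy h A) (subTy-renTy h B)
subTy-renTy h ⊤ₜ      = refl
subTy-renTy h 𝟎       = refl
subTy-renTy h (A & B) = cong₂ _&_ (subTy-renTy h A) (subTy-renTy h B)
subTy-renTy h (A ⊕ B) = cong₂ _⊕_ (subTy-renTy h A) (subTy-renTy h B)
subTy-renTy h (!ₜ A)  = cong !ₜ (subTy-renTy h A)
subTy-renTy h (∀ₜ A)  = cong ∀ₜ (subTy-renTy (extsTy-extR h) A)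

renTy-extsTy : {ρ : Fin n' → Fin n''} {σ : Fin n → Ty n'} {τ : Fin n → Ty n''} →
               renTy ρ ∘ σ ≗ τ → renTy (extR ρ) ∘ extsTy σ ≗ extsTy τ
renTy-extsTy h zero = refl
renTy-extsTy {ρ = ρ} {σ} {τ} h (suc i) = begin
  renTy (extR ρ) (renTy suc (σ i)) ≡⟨ renTy-renTy (λ _ → refl) (σ i) ⟩
  renTy (suc ∘ ρ) (σ i)            ≡⟨ renTy-renTy (λ _ → refl) (σ i) ⟨
  renTy suc (renTy ρ (σ i))        ≡⟨ cong (renTy suc) (h i) ⟩
  renTy suc (τ i)                  ∎

renTy-subTy : {ρ : Fin n' → Fin n''} {σ : Fin n → Ty n'} {τ : Fin n → Ty n''} →
              renTy ρ ∘ σ ≗ τ → renTy ρ ∘ subTy σ ≗ subTy τ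
renTy-subTy h (` x)   = h x
renTy-subTy h 𝟏       = refl
renTy-subTy h (A ⊸ B) = cong₂ _⊸_ (renTy-subTy h A) (renTy-subTy h B)
renTy-subTy h (A ⊗ B) = cong₂ _⊗_ (renTy-subTy h A) (renTy-subTy h B)
renTy-subTy h ⊤ₜ      = refl
renTy-subTy h 𝟎       = refl
renTy-subTy h (A & B) = cong₂ _&_ (renTy-subTy h A) (renTy-subTy h B)
renTy-subTy h (A ⊕ B) = cong₂ _⊕_ (renTy-subTy h A) (renTy-subTy h B)
renTy-subTy h (!ₜ A)  = cong !ₜ (renTy-subTy h A)
renTy-subTy h (∀ₜ A)  = cong ∀ₜ (renTy-subTy (renTy-extsTy h) A)

renTy-suc-subTy : (σ : Fin n → Ty n') (A : Ty n) →
                  renTy suc (subTy σ A) ≡ subTy (extsTy σ) (renTy suc A)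
renTy-suc-subTy σ A = begin
  renTy suc (subTy σ A)          ≡⟨ renTy-subTy (λ _ → refl) A ⟩
  subTy (renTy suc ∘ σ) A        ≡⟨ subTy-renTy (λ _ → refl) A ⟨
  subTy (extsTy σ) (renTy suc A) ∎

subTy-extsTy : {σ : Fin n' → Ty n''} {τ : Fin n → Ty n'} {υ : Fin n → Ty n''} →
               subTy σ ∘ τ ≗ υ → subTy (extsTy σ) ∘ extsTy τ ≗ extsTy υ
subTy-extsTy h zero = refl
subTy-extsTy {σ = σ} {τ} h (suc i) = trans (sym (renTy-suc-subTy σ (τ i))) (cong (renTy suc) (h i))

subTy-subTy : {σ : Fin n' → Ty n''} {τ : Fin n → Ty n'} {υ : Fin n → Ty n''} →
              subTy σ ∘ τ ≗ υ → subTy σ ∘ subTy τ ≗ subTy υ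
subTy-subTy h (` x)   = h x
subTy-subTy h 𝟏       = refl
subTy-subTy h (A ⊸ B) = cong₂ _⊸_ (subTy-subTy h A) (subTy-subTy h B)
subTy-subTy h (A ⊗ B) = cong₂ _⊗_ (subTy-subTy h A) (subTy-subTy h B)
subTy-subTy h ⊤ₜ      = refl
subTy-subTy h 𝟎       = refl
subTy-subTy h (A & B) = cong₂ _&_ (subTy-subTy h A) (subTy-subTy h B)
subTy-subTy h (A ⊕ B) = cong₂ _⊕_ (subTy-subTy h A) (subTy-subTy h B)
subTy-subTy h (!ₜ A)  = cong !ₜ (subTy-subTy h A)
subTy-subTy h (∀ₜ A)  = cong ∀ₜ (subTy-subTy (subTy-extsTy h) A)

extsTy-id : {σ : Fin n → Ty n} → σ ≗ `_ → extsTy σ ≗ `_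
extsTy-id h zero    = refl
extsTy-id h (suc i) = cong (renTy suc) (h i)

subTy-id : {σ : Fin n → Ty n} → σ ≗ `_ → subTy σ ≗ id
subTy-id h (` x)   = h x
subTy-id h 𝟏       = refl
subTy-id h (A ⊸ B) = cong₂ _⊸_ (subTy-id h A) (subTy-id h B)
subTy-id h (A ⊗ B) = cong₂ _⊗_ (subTy-id h A) (subTy-id h B)
subTy-id h ⊤ₜ      = refl
subTy-id h 𝟎       = refl
subTy-id h (A & B) = cong₂ _&_ (subTy-id h A) (subTy-id h B)
subTy-id h (A ⊕ B) = cong₂ _⊕_ (subTy-id h A) (subTy-id h B)
subTy-id h (!ₜ A)  = cong !ₜ (subTy-id h A)
subTy-id h (∀ₜ A)  = cong ∀ₜ (subTy-id (extsTy-id h) A)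

renTy≗subTy : {ρ : Fin n → Fin n'} {σ : Fin n → Ty n'} → `_ ∘ ρ ≗ σ → renTy ρ ≗ subTy σ
renTy≗subTy h (` x)   = h x
renTy≗subTy h 𝟏       = refl
renTy≗subTy h (A ⊸ B) = cong₂ _⊸_ (renTy≗subTy h A) (renTy≗subTy h B)
renTy≗subTy h (A ⊗ B) = cong₂ _⊗_ (renTy≗subTy h A) (renTy≗subTy h B)
renTy≗subTy h ⊤ₜ      = refl
renTy≗subTy h 𝟎       = refl
renTy≗subTy h (A & B) = cong₂ _&_ (renTy≗subTy h A) (renTy≗subTy h B)
renTy≗subTy h (A ⊕ B) = cong₂ _⊕_ (renTy≗subTy h A) (renTy≗subTy h B)
renTy≗subTy h (!ₜ A)  = cong !ₜ (renTy≗subTy h A)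
renTy≗subTy h (∀ₜ A)  = cong ∀ₜ (renTy≗subTy (extR≗extsTy h) A)
  where
  extR≗extsTy : {ρ : Fin n → Fin n'} {σ : Fin n → Ty n'} →
                `_ ∘ ρ ≗ σ → `_ ∘ extR ρ ≗ extsTy σ
  extR≗extsTy h zero    = refl
  extR≗extsTy h (suc i) = cong (renTy suc) (h i)

renTy-suc-[]ₜ : (A B : Ty n) → renTy suc A [ B ]ₜ ≡ A
renTy-suc-[]ₜ A B = trans (subTy-renTy (λ _ → refl) A) (subTy-id (λ _ → refl) A)

subTy-σ₀-extsTy : (σ : Fin n → Ty n') (B : Ty n) → subTy (σ₀ (subTy σ B)) ∘ extsTy σ ≗ subTy σ ∘ σ₀ B
subTy-σ₀-extsTy σ B zero    = refl
subTy-σ₀-extsTy σ B (suc i) = renTy-suc-[]ₜ (σ i) (subTy σ B)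

subTy-[]ₜ : (σ : Fin n → Ty n') (A : Ty (suc n)) (B : Ty n) →
            subTy σ (A [ B ]ₜ) ≡ subTy (extsTy σ) A [ subTy σ B ]ₜ
subTy-[]ₜ σ A B = trans (subTy-subTy (λ _ → refl) A) (sym (subTy-subTy (subTy-σ₀-extsTy σ B) A))

module Confluence {ℓ₁ ℓ₂} (𝒮 : Semiring ℓ₁ ℓ₂) where

  open Calculus 𝒮
  open Semiring 𝒮 using (Carrier) renaming (_+_ to _+ₛ_; _*_ to _*ₛ_)

  private variable
    m m' m'' : ℕ

  -- Renaming and substitution in proof-terms

  subTyTm-subTyTm : {σ : Fin n' → Ty n''} {τ : Fin n → Ty n'} {υ : Fin n → Ty n''} →
                    subTy σ ∘ τ ≗ υ → (t : Tm n m) → subTyTm σ (subTyTm τ t) ≡ subTyTm υ t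
  subTyTm-subTyTm h (var x)        = refl
  subTyTm-subTyTm h (t ⊞ u)        = cong₂ _⊞_ (subTyTm-subTyTm h t) (subTyTm-subTyTm h u)
  subTyTm-subTyTm h (a • t)        = cong (a •_) (subTyTm-subTyTm h t)
  subTyTm-subTyTm h (a ∙⋆)         = refl
  subTyTm-subTyTm h (δ𝟏 t u)       = cong₂ δ𝟏 (subTyTm-subTyTm h t) (subTyTm-subTyTm h u)
  subTyTm-subTyTm h (ƛ A t)        = cong₂ ƛ (subTy-subTy h A) (subTyTm-subTyTm h t)
  subTyTm-subTyTm h (t · u)        = cong₂ _·_ (subTyTm-subTyTm h t) (subTyTm-subTyTm h u)
  subTyTm-subTyTm h (t ⊗ₜ u)       = cong₂ _⊗ₜ_ (subTyTm-subTyTm h t) (subTyTm-subTyTm h u)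
  subTyTm-subTyTm h (δ⊗ t A B u)   =
    cong₄ δ⊗ (subTyTm-subTyTm h t) (subTy-subTy h A) (subTy-subTy h B) (subTyTm-subTyTm h u)
  subTyTm-subTyTm h ⟨⟩             = refl
  subTyTm-subTyTm h (δ𝟎 t)         = cong δ𝟎 (subTyTm-subTyTm h t)
  subTyTm-subTyTm h ⟨ t , u ⟩      = cong₂ ⟨_,_⟩ (subTyTm-subTyTm h t) (subTyTm-subTyTm h u)
  subTyTm-subTyTm h (δ&₁ t A u)    = cong₃ δ&₁ (subTyTm-subTyTm h t) (subTy-subTy h A) (subTyTm-subTyTm h u)
  subTyTm-subTyTm h (δ&₂ t A u)    = cong₃ δ&₂ (subTyTm-subTyTm h t) (subTy-subTy h A) (subTyTm-subTyTm h u)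
  subTyTm-subTyTm h (inl t)        = cong inl (subTyTm-subTyTm h t)
  subTyTm-subTyTm h (inr t)        = cong inr (subTyTm-subTyTm h t)
  subTyTm-subTyTm h (δ⊕ t A v B w) =
    cong₅ δ⊕ (subTyTm-subTyTm h t) (subTy-subTy h A) (subTyTm-subTyTm h v)
             (subTy-subTy h B) (subTyTm-subTyTm h w)
  subTyTm-subTyTm h (! t)          = cong !_ (subTyTm-subTyTm h t)
  subTyTm-subTyTm h (δ! t A u)     = cong₃ δ! (subTyTm-subTyTm h t) (subTy-subTy h A) (subTyTm-subTyTm h u)
  subTyTm-subTyTm h (Λ t)          = cong Λ (subTyTm-subTyTm (subTy-extsTy h) t)
  subTyTm-subTyTm h (t ·ᵀ A)       = cong₂ _·ᵀ_ (subTyTm-subTyTm h t) (subTy-subTy h A)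

  subTyTm-id : {σ : Fin n → Ty n} → σ ≗ `_ → (t : Tm n m) → subTyTm σ t ≡ t
  subTyTm-id h (var x)        = refl
  subTyTm-id h (t ⊞ u)        = cong₂ _⊞_ (subTyTm-id h t) (subTyTm-id h u)
  subTyTm-id h (a • t)        = cong (a •_) (subTyTm-id h t)
  subTyTm-id h (a ∙⋆)         = refl
  subTyTm-id h (δ𝟏 t u)       = cong₂ δ𝟏 (subTyTm-id h t) (subTyTm-id h u)
  subTyTm-id h (ƛ A t)        = cong₂ ƛ (subTy-id h A) (subTyTm-id h t)
  subTyTm-id h (t · u)        = cong₂ _·_ (subTyTm-id h t) (subTyTm-id h u)
  subTyTm-id h (t ⊗ₜ u)       = cong₂ _⊗ₜ_ (subTyTm-id h t) (subTyTm-id h u)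
  subTyTm-id h (δ⊗ t A B u)   = cong₄ δ⊗ (subTyTm-id h t) (subTy-id h A) (subTy-id h B) (subTyTm-id h u)
  subTyTm-id h ⟨⟩             = refl
  subTyTm-id h (δ𝟎 t)         = cong δ𝟎 (subTyTm-id h t)
  subTyTm-id h ⟨ t , u ⟩      = cong₂ ⟨_,_⟩ (subTyTm-id h t) (subTyTm-id h u)
  subTyTm-id h (δ&₁ t A u)    = cong₃ δ&₁ (subTyTm-id h t) (subTy-id h A) (subTyTm-id h u)
  subTyTm-id h (δ&₂ t A u)    = cong₃ δ&₂ (subTyTm-id h t) (subTy-id h A) (subTyTm-id h u)
  subTyTm-id h (inl t)        = cong inl (subTyTm-id h t)
  subTyTm-id h (inr t)        = cong inr (subTyTm-id h t)
  subTyTm-id h (δ⊕ t A v B w) =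
    cong₅ δ⊕ (subTyTm-id h t) (subTy-id h A) (subTyTm-id h v) (subTy-id h B) (subTyTm-id h w)
  subTyTm-id h (! t)          = cong !_ (subTyTm-id h t)
  subTyTm-id h (δ! t A u)     = cong₃ δ! (subTyTm-id h t) (subTy-id h A) (subTyTm-id h u)
  subTyTm-id h (Λ t)          = cong Λ (subTyTm-id (extsTy-id h) t)
  subTyTm-id h (t ·ᵀ A)       = cong₂ _·ᵀ_ (subTyTm-id h t) (subTy-id h A)

  renTm-subTyTm : {ρ : Fin m → Fin m'} {σ : Fin n → Ty n'} (t : Tm n m) →
                  renTm ρ (subTyTm σ t) ≡ subTyTm σ (renTm ρ t)
  renTm-subTyTm (var x)        = refl
  renTm-subTyTm (t ⊞ u)        = cong₂ _⊞_ (renTm-subTyTm t) (renTm-subTyTm u)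
  renTm-subTyTm (a • t)        = cong (a •_) (renTm-subTyTm t)
  renTm-subTyTm (a ∙⋆)         = refl
  renTm-subTyTm (δ𝟏 t u)       = cong₂ δ𝟏 (renTm-subTyTm t) (renTm-subTyTm u)
  renTm-subTyTm (ƛ A t)        = cong (ƛ _) (renTm-subTyTm t)
  renTm-subTyTm (t · u)        = cong₂ _·_ (renTm-subTyTm t) (renTm-subTyTm u)
  renTm-subTyTm (t ⊗ₜ u)       = cong₂ _⊗ₜ_ (renTm-subTyTm t) (renTm-subTyTm u)
  renTm-subTyTm (δ⊗ t A B u)   = cong₂ (λ x y → δ⊗ x _ _ y) (renTm-subTyTm t) (renTm-subTyTm u)
  renTm-subTyTm ⟨⟩             = refl
  renTm-subTyTm (δ𝟎 t)         = cong δ𝟎 (renTm-subTyTm t)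
  renTm-subTyTm ⟨ t , u ⟩      = cong₂ ⟨_,_⟩ (renTm-subTyTm t) (renTm-subTyTm u)
  renTm-subTyTm (δ&₁ t A u)    = cong₂ (λ x y → δ&₁ x _ y) (renTm-subTyTm t) (renTm-subTyTm u)
  renTm-subTyTm (δ&₂ t A u)    = cong₂ (λ x y → δ&₂ x _ y) (renTm-subTyTm t) (renTm-subTyTm u)
  renTm-subTyTm (inl t)        = cong inl (renTm-subTyTm t)
  renTm-subTyTm (inr t)        = cong inr (renTm-subTyTm t)
  renTm-subTyTm (δ⊕ t A v B w) =
    cong₃ (λ x y z → δ⊕ x _ y _ z) (renTm-subTyTm t) (renTm-subTyTm v) (renTm-subTyTm w)
  renTm-subTyTm (! t)          = cong !_ (renTm-subTyTm t)
  renTm-subTyTm (δ! t A u)     = cong₂ (λ x y → δ! x _ y) (renTm-subTyTm t) (renTm-subTyTm u)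
  renTm-subTyTm (Λ t)          = cong Λ (renTm-subTyTm t)
  renTm-subTyTm (t ·ᵀ A)       = cong (_·ᵀ _) (renTm-subTyTm t)

  renTm-renTm : {ρ : Fin m' → Fin m''} {ρ' : Fin m → Fin m'} {ρ'' : Fin m → Fin m''} →
                ρ ∘ ρ' ≗ ρ'' → (t : Tm n m) → renTm ρ (renTm ρ' t) ≡ renTm ρ'' t
  renTm-renTm h (var x)        = cong var (h x)
  renTm-renTm h (t ⊞ u)        = cong₂ _⊞_ (renTm-renTm h t) (renTm-renTm h u)
  renTm-renTm h (a • t)        = cong (a •_) (renTm-renTm h t)
  renTm-renTm h (a ∙⋆)         = refl
  renTm-renTm h (δ𝟏 t u)       = cong₂ δ𝟏 (renTm-renTm h t) (renTm-renTm h u)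
  renTm-renTm h (ƛ A t)        = cong (ƛ A) (renTm-renTm (extR-extR h) t)
  renTm-renTm h (t · u)        = cong₂ _·_ (renTm-renTm h t) (renTm-renTm h u)
  renTm-renTm h (t ⊗ₜ u)       = cong₂ _⊗ₜ_ (renTm-renTm h t) (renTm-renTm h u)
  renTm-renTm h (δ⊗ t A B u)   =
    cong₂ (λ x y → δ⊗ x A B y) (renTm-renTm h t) (renTm-renTm (extR-extR (extR-extR h)) u)
  renTm-renTm h ⟨⟩             = refl
  renTm-renTm h (δ𝟎 t)         = cong δ𝟎 (renTm-renTm h t)
  renTm-renTm h ⟨ t , u ⟩      = cong₂ ⟨_,_⟩ (renTm-renTm h t) (renTm-renTm h u)
  renTm-renTm h (δ&₁ t A u)    = cong₂ (λ x y → δ&₁ x A y) (renTm-renTm h t) (renTm-renTm (extR-extR h) u)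
  renTm-renTm h (δ&₂ t A u)    = cong₂ (λ x y → δ&₂ x A y) (renTm-renTm h t) (renTm-renTm (extR-extR h) u)
  renTm-renTm h (inl t)        = cong inl (renTm-renTm h t)
  renTm-renTm h (inr t)        = cong inr (renTm-renTm h t)
  renTm-renTm h (δ⊕ t A v B w) =
    cong₃ (λ x y z → δ⊕ x A y B z) (renTm-renTm h t) (renTm-renTm (extR-extR h) v)
                                   (renTm-renTm (extR-extR h) w)
  renTm-renTm h (! t)          = cong !_ (renTm-renTm h t)
  renTm-renTm h (δ! t A u)     = cong₂ (λ x y → δ! x A y) (renTm-renTm h t) (renTm-renTm (extR-extR h) u)
  renTm-renTm h (Λ t)          = cong Λ (renTm-renTm h t)
  renTm-renTm h (t ·ᵀ A)       = cong (_·ᵀ A) (renTm-renTm h t)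

  extsTm-extR : {σ : Fin m' → Tm n m''} {ρ : Fin m → Fin m'} {τ : Fin m → Tm n m''} →
                σ ∘ ρ ≗ τ → extsTm σ ∘ extR ρ ≗ extsTm τ
  extsTm-extR h zero    = refl
  extsTm-extR h (suc i) = cong (renTm suc) (h i)

  subTm-renTm : {σ : Fin m' → Tm n m''} {ρ : Fin m → Fin m'} {τ : Fin m → Tm n m''} →
                σ ∘ ρ ≗ τ → (t : Tm n m) → subTm σ (renTm ρ t) ≡ subTm τ t
  subTm-renTm h (var x)        = h x
  subTm-renTm h (t ⊞ u)        = cong₂ _⊞_ (subTm-renTm h t) (subTm-renTm h u)
  subTm-renTm h (a • t)        = cong (a •_) (subTm-renTm h t)
  subTm-renTm h (a ∙⋆)         = refl
  subTm-renTm h (δ𝟏 t u)       = cong₂ δ𝟏 (subTm-renTm h t) (subTm-renTm h u)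
  subTm-renTm h (ƛ A t)        = cong (ƛ A) (subTm-renTm (extsTm-extR h) t)
  subTm-renTm h (t · u)        = cong₂ _·_ (subTm-renTm h t) (subTm-renTm h u)
  subTm-renTm h (t ⊗ₜ u)       = cong₂ _⊗ₜ_ (subTm-renTm h t) (subTm-renTm h u)
  subTm-renTm h (δ⊗ t A B u)   =
    cong₂ (λ x y → δ⊗ x A B y) (subTm-renTm h t) (subTm-renTm (extsTm-extR (extsTm-extR h)) u)
  subTm-renTm h ⟨⟩             = refl
  subTm-renTm h (δ𝟎 t)         = cong δ𝟎 (subTm-renTm h t)
  subTm-renTm h ⟨ t , u ⟩      = cong₂ ⟨_,_⟩ (subTm-renTm h t) (subTm-renTm h u)
  subTm-renTm h (δ&₁ t A u)    = cong₂ (λ x y → δ&₁ x A y) (subTm-renTm h t) (subTm-renTm (extsTm-extR h) u)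
  subTm-renTm h (δ&₂ t A u)    = cong₂ (λ x y → δ&₂ x A y) (subTm-renTm h t) (subTm-renTm (extsTm-extR h) u)
  subTm-renTm h (inl t)        = cong inl (subTm-renTm h t)
  subTm-renTm h (inr t)        = cong inr (subTm-renTm h t)
  subTm-renTm h (δ⊕ t A v B w) =
    cong₃ (λ x y z → δ⊕ x A y B z) (subTm-renTm h t) (subTm-renTm (extsTm-extR h) v)
                                   (subTm-renTm (extsTm-extR h) w)
  subTm-renTm h (! t)          = cong !_ (subTm-renTm h t)
  subTm-renTm h (δ! t A u)     = cong₂ (λ x y → δ! x A y) (subTm-renTm h t) (subTm-renTm (extsTm-extR h) u)
  subTm-renTm h (Λ t)          = cong Λ (subTm-renTm (cong wkTyTm ∘ h) t)
  subTm-renTm h (t ·ᵀ A)       = cong (_·ᵀ A) (subTm-renTm h t)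

  renTm-extsTm : {ρ : Fin m' → Fin m''} {σ : Fin m → Tm n m'} {τ : Fin m → Tm n m''} →
                 renTm ρ ∘ σ ≗ τ → renTm (extR ρ) ∘ extsTm σ ≗ extsTm τ
  renTm-extsTm h zero = refl
  renTm-extsTm {ρ = ρ} {σ} {τ} h (suc i) = begin
    renTm (extR ρ) (renTm suc (σ i)) ≡⟨ renTm-renTm (λ _ → refl) (σ i) ⟩
    renTm (suc ∘ ρ) (σ i)            ≡⟨ renTm-renTm (λ _ → refl) (σ i) ⟨
    renTm suc (renTm ρ (σ i))        ≡⟨ cong (renTm suc) (h i) ⟩
    renTm suc (τ i)                  ∎

  renTm-subTm : {ρ : Fin m' → Fin m''} {σ : Fin m → Tm n m'} {τ : Fin m → Tm n m''} →
                renTm ρ ∘ σ ≗ τ → (t : Tm n m) → renTm ρ (subTm σ t) ≡ subTm τ t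
  renTm-subTm h (var x)        = h x
  renTm-subTm h (t ⊞ u)        = cong₂ _⊞_ (renTm-subTm h t) (renTm-subTm h u)
  renTm-subTm h (a • t)        = cong (a •_) (renTm-subTm h t)
  renTm-subTm h (a ∙⋆)         = refl
  renTm-subTm h (δ𝟏 t u)       = cong₂ δ𝟏 (renTm-subTm h t) (renTm-subTm h u)
  renTm-subTm h (ƛ A t)        = cong (ƛ A) (renTm-subTm (renTm-extsTm h) t)
  renTm-subTm h (t · u)        = cong₂ _·_ (renTm-subTm h t) (renTm-subTm h u)
  renTm-subTm h (t ⊗ₜ u)       = cong₂ _⊗ₜ_ (renTm-subTm h t) (renTm-subTm h u)
  renTm-subTm h (δ⊗ t A B u)   =
    cong₂ (λ x y → δ⊗ x A B y) (renTm-subTm h t) (renTm-subTm (renTm-extsTm (renTm-extsTm h)) u)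
  renTm-subTm h ⟨⟩             = refl
  renTm-subTm h (δ𝟎 t)         = cong δ𝟎 (renTm-subTm h t)
  renTm-subTm h ⟨ t , u ⟩      = cong₂ ⟨_,_⟩ (renTm-subTm h t) (renTm-subTm h u)
  renTm-subTm h (δ&₁ t A u)    = cong₂ (λ x y → δ&₁ x A y) (renTm-subTm h t) (renTm-subTm (renTm-extsTm h) u)
  renTm-subTm h (δ&₂ t A u)    = cong₂ (λ x y → δ&₂ x A y) (renTm-subTm h t) (renTm-subTm (renTm-extsTm h) u)
  renTm-subTm h (inl t)        = cong inl (renTm-subTm h t)
  renTm-subTm h (inr t)        = cong inr (renTm-subTm h t)
  renTm-subTm h (δ⊕ t A v B w) =
    cong₃ (λ x y z → δ⊕ x A y B z) (renTm-subTm h t) (renTm-subTm (renTm-extsTm h) v)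
                                   (renTm-subTm (renTm-extsTm h) w)
  renTm-subTm h (! t)          = cong !_ (renTm-subTm h t)
  renTm-subTm h (δ! t A u)     = cong₂ (λ x y → δ! x A y) (renTm-subTm h t) (renTm-subTm (renTm-extsTm h) u)
  renTm-subTm {σ = σ} h (Λ t)  =
    cong Λ (renTm-subTm (λ i → trans (renTm-subTyTm (σ i)) (cong wkTyTm (h i))) t)
  renTm-subTm h (t ·ᵀ A)       = cong (_·ᵀ A) (renTm-subTm h t)

  subTyTm-wkTyTm : (σ : Fin n → Ty n') (t : Tm n m) →
                   subTyTm (extsTy σ) (wkTyTm t) ≡ wkTyTm (subTyTm σ t)
  subTyTm-wkTyTm σ t = begin
    subTyTm (extsTy σ) (wkTyTm t)  ≡⟨ subTyTm-subTyTm (λ _ → refl) t ⟩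
    subTyTm (renTy suc ∘ σ) t      ≡⟨ subTyTm-subTyTm (sym ∘ renTy≗subTy (λ _ → refl) ∘ σ) t ⟨
    wkTyTm (subTyTm σ t)           ∎

  subTyTm-extsTm : {ρ : Fin n → Ty n'} {σ : Fin m → Tm n m'} {τ : Fin m → Tm n' m'} →
                   subTyTm ρ ∘ σ ≗ τ → subTyTm ρ ∘ extsTm σ ≗ extsTm τ
  subTyTm-extsTm h zero    = refl
  subTyTm-extsTm {σ = σ} h (suc i) = trans (sym (renTm-subTyTm (σ i))) (cong (renTm suc) (h i))

  subTyTm-subTm : {ρ : Fin n → Ty n'} {σ : Fin m → Tm n m'} {τ : Fin m → Tm n' m'} →
                  subTyTm ρ ∘ σ ≗ τ → (t : Tm n m) → subTyTm ρ (subTm σ t) ≡ subTm τ (subTyTm ρ t)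
  subTyTm-subTm h (var x)        = h x
  subTyTm-subTm h (t ⊞ u)        = cong₂ _⊞_ (subTyTm-subTm h t) (subTyTm-subTm h u)
  subTyTm-subTm h (a • t)        = cong (a •_) (subTyTm-subTm h t)
  subTyTm-subTm h (a ∙⋆)         = refl
  subTyTm-subTm h (δ𝟏 t u)       = cong₂ δ𝟏 (subTyTm-subTm h t) (subTyTm-subTm h u)
  subTyTm-subTm h (ƛ A t)        = cong (ƛ _) (subTyTm-subTm (subTyTm-extsTm h) t)
  subTyTm-subTm h (t · u)        = cong₂ _·_ (subTyTm-subTm h t) (subTyTm-subTm h u)
  subTyTm-subTm h (t ⊗ₜ u)       = cong₂ _⊗ₜ_ (subTyTm-subTm h t) (subTyTm-subTm h u)
  subTyTm-subTm h (δ⊗ t A B u)   =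
    cong₂ (λ x y → δ⊗ x _ _ y) (subTyTm-subTm h t) (subTyTm-subTm (subTyTm-extsTm (subTyTm-extsTm h)) u)
  subTyTm-subTm h ⟨⟩             = refl
  subTyTm-subTm h (δ𝟎 t)         = cong δ𝟎 (subTyTm-subTm h t)
  subTyTm-subTm h ⟨ t , u ⟩      = cong₂ ⟨_,_⟩ (subTyTm-subTm h t) (subTyTm-subTm h u)
  subTyTm-subTm h (δ&₁ t A u) =
    cong₂ (λ x y → δ&₁ x _ y) (subTyTm-subTm h t) (subTyTm-subTm (subTyTm-extsTm h) u)
  subTyTm-subTm h (δ&₂ t A u) =
    cong₂ (λ x y → δ&₂ x _ y) (subTyTm-subTm h t) (subTyTm-subTm (subTyTm-extsTm h) u)
  subTyTm-subTm h (inl t)        = cong inl (subTyTm-subTm h t)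
  subTyTm-subTm h (inr t)        = cong inr (subTyTm-subTm h t)
  subTyTm-subTm h (δ⊕ t A v B w) =
    cong₃ (λ x y z → δ⊕ x _ y _ z) (subTyTm-subTm h t) (subTyTm-subTm (subTyTm-extsTm h) v)
                                   (subTyTm-subTm (subTyTm-extsTm h) w)
  subTyTm-subTm h (! t)          = cong !_ (subTyTm-subTm h t)
  subTyTm-subTm h (δ! t A u) =
    cong₂ (λ x y → δ! x _ y) (subTyTm-subTm h t) (subTyTm-subTm (subTyTm-extsTm h) u)
  subTyTm-subTm {ρ = ρ} {σ} h (Λ t) =
    cong Λ (subTyTm-subTm (λ i → trans (subTyTm-wkTyTm ρ (σ i)) (cong wkTyTm (h i))) t)
  subTyTm-subTm h (t ·ᵀ A)       = cong (_·ᵀ _) (subTyTm-subTm h t)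

  subTm-extsTm : {σ : Fin m' → Tm n m''} {τ : Fin m → Tm n m'} {υ : Fin m → Tm n m''} →
                 subTm σ ∘ τ ≗ υ → subTm (extsTm σ) ∘ extsTm τ ≗ extsTm υ
  subTm-extsTm h zero = refl
  subTm-extsTm {σ = σ} {τ} {υ} h (suc i) = begin
    subTm (extsTm σ) (renTm suc (τ i)) ≡⟨ subTm-renTm (λ _ → refl) (τ i) ⟩
    subTm (renTm suc ∘ σ) (τ i)        ≡⟨ renTm-subTm (λ _ → refl) (τ i) ⟨
    renTm suc (subTm σ (τ i))          ≡⟨ cong (renTm suc) (h i) ⟩
    renTm suc (υ i)                    ∎

  subTm-subTm : {σ : Fin m' → Tm n m''} {τ : Fin m → Tm n m'} {υ : Fin m → Tm n m''} →
                subTm σ ∘ τ ≗ υ → (t : Tm n m) → subTm σ (subTm τ t) ≡ subTm υ t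
  subTm-subTm h (var x)        = h x
  subTm-subTm h (t ⊞ u)        = cong₂ _⊞_ (subTm-subTm h t) (subTm-subTm h u)
  subTm-subTm h (a • t)        = cong (a •_) (subTm-subTm h t)
  subTm-subTm h (a ∙⋆)         = refl
  subTm-subTm h (δ𝟏 t u)       = cong₂ δ𝟏 (subTm-subTm h t) (subTm-subTm h u)
  subTm-subTm h (ƛ A t)        = cong (ƛ A) (subTm-subTm (subTm-extsTm h) t)
  subTm-subTm h (t · u)        = cong₂ _·_ (subTm-subTm h t) (subTm-subTm h u)
  subTm-subTm h (t ⊗ₜ u)       = cong₂ _⊗ₜ_ (subTm-subTm h t) (subTm-subTm h u)
  subTm-subTm h (δ⊗ t A B u)   =
    cong₂ (λ x y → δ⊗ x A B y) (subTm-subTm h t) (subTm-subTm (subTm-extsTm (subTm-extsTm h)) u)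
  subTm-subTm h ⟨⟩             = refl
  subTm-subTm h (δ𝟎 t)         = cong δ𝟎 (subTm-subTm h t)
  subTm-subTm h ⟨ t , u ⟩      = cong₂ ⟨_,_⟩ (subTm-subTm h t) (subTm-subTm h u)
  subTm-subTm h (δ&₁ t A u)    = cong₂ (λ x y → δ&₁ x A y) (subTm-subTm h t) (subTm-subTm (subTm-extsTm h) u)
  subTm-subTm h (δ&₂ t A u)    = cong₂ (λ x y → δ&₂ x A y) (subTm-subTm h t) (subTm-subTm (subTm-extsTm h) u)
  subTm-subTm h (inl t)        = cong inl (subTm-subTm h t)
  subTm-subTm h (inr t)        = cong inr (subTm-subTm h t)
  subTm-subTm h (δ⊕ t A v B w) =
    cong₃ (λ x y z → δ⊕ x A y B z) (subTm-subTm h t) (subTm-subTm (subTm-extsTm h) v)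
                                   (subTm-subTm (subTm-extsTm h) w)
  subTm-subTm h (! t)          = cong !_ (subTm-subTm h t)
  subTm-subTm h (δ! t A u)     = cong₂ (λ x y → δ! x A y) (subTm-subTm h t) (subTm-subTm (subTm-extsTm h) u)
  subTm-subTm {τ = τ} h (Λ t)  =
    cong Λ (subTm-subTm (λ i → trans (sym (subTyTm-subTm (λ _ → refl) (τ i))) (cong wkTyTm (h i))) t)
  subTm-subTm h (t ·ᵀ A)       = cong (_·ᵀ A) (subTm-subTm h t)

  extsTm-id : {σ : Fin m → Tm n m} → σ ≗ var → extsTm σ ≗ var
  extsTm-id h zero    = refl
  extsTm-id h (suc i) = cong (renTm suc) (h i)

  subTm-id : {σ : Fin m → Tm n m} → σ ≗ var → (t : Tm n m) → subTm σ t ≡ t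
  subTm-id h (var x)        = h x
  subTm-id h (t ⊞ u)        = cong₂ _⊞_ (subTm-id h t) (subTm-id h u)
  subTm-id h (a • t)        = cong (a •_) (subTm-id h t)
  subTm-id h (a ∙⋆)         = refl
  subTm-id h (δ𝟏 t u)       = cong₂ δ𝟏 (subTm-id h t) (subTm-id h u)
  subTm-id h (ƛ A t)        = cong (ƛ A) (subTm-id (extsTm-id h) t)
  subTm-id h (t · u)        = cong₂ _·_ (subTm-id h t) (subTm-id h u)
  subTm-id h (t ⊗ₜ u)       = cong₂ _⊗ₜ_ (subTm-id h t) (subTm-id h u)
  subTm-id h (δ⊗ t A B u)   =
    cong₂ (λ x y → δ⊗ x A B y) (subTm-id h t) (subTm-id (extsTm-id (extsTm-id h)) u)
  subTm-id h ⟨⟩             = refl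
  subTm-id h (δ𝟎 t)         = cong δ𝟎 (subTm-id h t)
  subTm-id h ⟨ t , u ⟩      = cong₂ ⟨_,_⟩ (subTm-id h t) (subTm-id h u)
  subTm-id h (δ&₁ t A u)    = cong₂ (λ x y → δ&₁ x A y) (subTm-id h t) (subTm-id (extsTm-id h) u)
  subTm-id h (δ&₂ t A u)    = cong₂ (λ x y → δ&₂ x A y) (subTm-id h t) (subTm-id (extsTm-id h) u)
  subTm-id h (inl t)        = cong inl (subTm-id h t)
  subTm-id h (inr t)        = cong inr (subTm-id h t)
  subTm-id h (δ⊕ t A v B w) =
    cong₃ (λ x y z → δ⊕ x A y B z) (subTm-id h t) (subTm-id (extsTm-id h) v)
                                   (subTm-id (extsTm-id h) w)
  subTm-id h (! t)          = cong !_ (subTm-id h t)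
  subTm-id h (δ! t A u)     = cong₂ (λ x y → δ! x A y) (subTm-id h t) (subTm-id (extsTm-id h) u)
  subTm-id h (Λ t)          = cong Λ (subTm-id (cong wkTyTm ∘ h) t)
  subTm-id h (t ·ᵀ A)       = cong (_·ᵀ A) (subTm-id h t)

  subTm-renTm-cancel : {σ : Fin m' → Tm n m} {ρ : Fin m → Fin m'} →
                       σ ∘ ρ ≗ var → (t : Tm n m) → subTm σ (renTm ρ t) ≡ t
  subTm-renTm-cancel h t = trans (subTm-renTm h t) (subTm-id (λ _ → refl) t)

  renTm-[] : (ρ : Fin m → Fin m') (t : Tm n (suc m)) (u : Tm n m) →
             renTm ρ (t [ u ]) ≡ renTm (extR ρ) t [ renTm ρ u ]
  renTm-[] ρ t u = trans (renTm-subTm (λ _ → refl) t) (sym (subTm-renTm ς₁-extR t))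
    where
    ς₁-extR : ς₁ (renTm ρ u) ∘ extR ρ ≗ renTm ρ ∘ ς₁ u
    ς₁-extR zero    = refl
    ς₁-extR (suc i) = refl

  renTm-[,] : (ρ : Fin m → Fin m') (t : Tm n (suc (suc m))) (u v : Tm n m) →
              renTm ρ (t [ u , v ]) ≡ renTm (extR (extR ρ)) t [ renTm ρ u , renTm ρ v ]
  renTm-[,] ρ t u v = trans (renTm-subTm (λ _ → refl) t) (sym (subTm-renTm ς₂-extR t))
    where
    ς₂-extR : ς₂ (renTm ρ u) (renTm ρ v) ∘ extR (extR ρ) ≗ renTm ρ ∘ ς₂ u v
    ς₂-extR zero          = refl
    ς₂-extR (suc zero)    = refl
    ς₂-extR (suc (suc i)) = refl

  subTyTm-[] : (σ : Fin n → Ty n') (t : Tm n (suc m)) (u : Tm n m) →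
               subTyTm σ (t [ u ]) ≡ subTyTm σ t [ subTyTm σ u ]
  subTyTm-[] σ t u = subTyTm-subTm ς₁-subTyTm t
    where
    ς₁-subTyTm : subTyTm σ ∘ ς₁ u ≗ ς₁ (subTyTm σ u)
    ς₁-subTyTm zero    = refl
    ς₁-subTyTm (suc i) = refl

  subTyTm-[,] : (σ : Fin n → Ty n') (t : Tm n (suc (suc m))) (u v : Tm n m) →
                subTyTm σ (t [ u , v ]) ≡ subTyTm σ t [ subTyTm σ u , subTyTm σ v ]
  subTyTm-[,] σ t u v = subTyTm-subTm ς₂-subTyTm t
    where
    ς₂-subTyTm : subTyTm σ ∘ ς₂ u v ≗ ς₂ (subTyTm σ u) (subTyTm σ v)
    ς₂-subTyTm zero          = refl
    ς₂-subTyTm (suc zero)    = refl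
    ς₂-subTyTm (suc (suc i)) = refl

  subTyTm-[]ᵀ : (σ : Fin n → Ty n') (t : Tm (suc n) m) (B : Ty n) →
                subTyTm σ (t [ B ]ᵀ) ≡ subTyTm (extsTy σ) t [ subTy σ B ]ᵀ
  subTyTm-[]ᵀ σ t B =
    trans (subTyTm-subTyTm (λ _ → refl) t) (sym (subTyTm-subTyTm (subTy-σ₀-extsTy σ B) t))

  subTm-[] : (σ : Fin m → Tm n m') (t : Tm n (suc m)) (u : Tm n m) →
             subTm σ (t [ u ]) ≡ subTm (extsTm σ) t [ subTm σ u ]
  subTm-[] σ t u = trans (subTm-subTm (λ _ → refl) t) (sym (subTm-subTm ς₁-extsTm t))
    where
    ς₁-extsTm : subTm (ς₁ (subTm σ u)) ∘ extsTm σ ≗ subTm σ ∘ ς₁ u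
    ς₁-extsTm zero    = refl
    ς₁-extsTm (suc i) = subTm-renTm-cancel (λ _ → refl) (σ i)

  subTm-[,] : (σ : Fin m → Tm n m') (t : Tm n (suc (suc m))) (u v : Tm n m) →
              subTm σ (t [ u , v ]) ≡ subTm (extsTm (extsTm σ)) t [ subTm σ u , subTm σ v ]
  subTm-[,] σ t u v = trans (subTm-subTm (λ _ → refl) t) (sym (subTm-subTm ς₂-extsTm t))
    where
    ς₂-extsTm : subTm (ς₂ (subTm σ u) (subTm σ v)) ∘ extsTm (extsTm σ) ≗ subTm σ ∘ ς₂ u v
    ς₂-extsTm zero          = refl
    ς₂-extsTm (suc zero)    = refl
    ς₂-extsTm (suc (suc i)) =
      trans (cong (subTm _) (renTm-renTm (λ _ → refl) (σ i))) (subTm-renTm-cancel (λ _ → refl) (σ i))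

  subTm-[]ᵀ : (σ : Fin m → Tm n m') (t : Tm (suc n) m) (B : Ty n) →
              subTm σ (t [ B ]ᵀ) ≡ subTm (wkTyTm ∘ σ) t [ B ]ᵀ
  subTm-[]ᵀ σ t B = sym (subTyTm-subTm σ₀-wkTyTm t)
    where
    σ₀-wkTyTm : subTyTm (σ₀ B) ∘ wkTyTm ∘ σ ≗ σ
    σ₀-wkTyTm i = trans (subTyTm-subTyTm (λ _ → refl) (σ i)) (subTyTm-id (λ _ → refl) (σ i))

  -- Typing is stable under renaming and substitution

  private variable
    Γ : Ctx n m

  lookup-extR : {Δ : Ctx n m'} {ρ : Fin m → Fin m'} {A : Ty n} →
                lookup Δ ∘ ρ ≗ lookup Γ → lookup (A ∷ Δ) ∘ extR ρ ≗ lookup (A ∷ Γ)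
  lookup-extR h zero    = refl
  lookup-extR h (suc i) = h i

  lookup-map-renTy-suc : {Δ : Ctx n m'} {ρ : Fin m → Fin m'} → lookup Δ ∘ ρ ≗ lookup Γ →
                         lookup (map (renTy suc) Δ) ∘ ρ ≗ lookup (map (renTy suc) Γ)
  lookup-map-renTy-suc {Γ = Γ} {Δ = Δ} {ρ} h i = begin
    lookup (map (renTy suc) Δ) (ρ i) ≡⟨ lookup-map (ρ i) (renTy suc) Δ ⟩
    renTy suc (lookup Δ (ρ i))       ≡⟨ cong (renTy suc) (h i) ⟩
    renTy suc (lookup Γ i)           ≡⟨ lookup-map i (renTy suc) Γ ⟨
    lookup (map (renTy suc) Γ) i     ∎

  ⊢renTm : {Δ : Ctx n m'} {ρ : Fin m → Fin m'} {t : Tm n m} {A : Ty n} →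
           lookup Δ ∘ ρ ≗ lookup Γ → Γ ⊢ t ∶ A → Δ ⊢ renTm ρ t ∶ A
  ⊢renTm {Δ = Δ} {ρ} h (⊢var {x = x}) = subst (Δ ⊢ var (ρ x) ∶_) (h x) ⊢var
  ⊢renTm h (⊢⊞ ⊢t ⊢u)     = ⊢⊞ (⊢renTm h ⊢t) (⊢renTm h ⊢u)
  ⊢renTm h (⊢• ⊢t)        = ⊢• (⊢renTm h ⊢t)
  ⊢renTm h ⊢⋆             = ⊢⋆
  ⊢renTm h (⊢δ𝟏 ⊢t ⊢u)    = ⊢δ𝟏 (⊢renTm h ⊢t) (⊢renTm h ⊢u)
  ⊢renTm h (⊢ƛ ⊢t)        = ⊢ƛ (⊢renTm (lookup-extR h) ⊢t)
  ⊢renTm h (⊢· ⊢t ⊢u)     = ⊢· (⊢renTm h ⊢t) (⊢renTm h ⊢u)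
  ⊢renTm h (⊢⊗ ⊢t ⊢u)     = ⊢⊗ (⊢renTm h ⊢t) (⊢renTm h ⊢u)
  ⊢renTm h (⊢δ⊗ ⊢t ⊢u)    = ⊢δ⊗ (⊢renTm h ⊢t) (⊢renTm (lookup-extR (lookup-extR h)) ⊢u)
  ⊢renTm h ⊢⟨⟩            = ⊢⟨⟩
  ⊢renTm h (⊢δ𝟎 ⊢t)       = ⊢δ𝟎 (⊢renTm h ⊢t)
  ⊢renTm h (⊢⟨,⟩ ⊢t ⊢u)   = ⊢⟨,⟩ (⊢renTm h ⊢t) (⊢renTm h ⊢u)
  ⊢renTm h (⊢δ&₁ ⊢t ⊢u)   = ⊢δ&₁ (⊢renTm h ⊢t) (⊢renTm (lookup-extR h) ⊢u)
  ⊢renTm h (⊢δ&₂ ⊢t ⊢u)   = ⊢δ&₂ (⊢renTm h ⊢t) (⊢renTm (lookup-extR h) ⊢u)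
  ⊢renTm h (⊢inl ⊢t)      = ⊢inl (⊢renTm h ⊢t)
  ⊢renTm h (⊢inr ⊢t)      = ⊢inr (⊢renTm h ⊢t)
  ⊢renTm h (⊢δ⊕ ⊢t ⊢v ⊢w) = ⊢δ⊕ (⊢renTm h ⊢t) (⊢renTm (lookup-extR h) ⊢v) (⊢renTm (lookup-extR h) ⊢w)
  ⊢renTm h (⊢! ⊢t)        = ⊢! (⊢renTm h ⊢t)
  ⊢renTm h (⊢δ! ⊢t ⊢u)    = ⊢δ! (⊢renTm h ⊢t) (⊢renTm (lookup-extR h) ⊢u)
  ⊢renTm {Γ = Γ} {Δ = Δ} h (⊢Λ ⊢t) = ⊢Λ (⊢renTm (lookup-map-renTy-suc {Γ = Γ} {Δ = Δ} h) ⊢t)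
  ⊢renTm h (⊢·ᵀ ⊢t)       = ⊢·ᵀ (⊢renTm h ⊢t)

  lookup-∷-subTy : {Δ : Ctx n' m} {σ : Fin n → Ty n'} {A : Ty n} →
                   lookup Δ ≗ subTy σ ∘ lookup Γ → lookup (subTy σ A ∷ Δ) ≗ subTy σ ∘ lookup (A ∷ Γ)
  lookup-∷-subTy h zero    = refl
  lookup-∷-subTy h (suc i) = h i

  lookup-map-renTy-suc-subTy : {Δ : Ctx n' m} {σ : Fin n → Ty n'} → lookup Δ ≗ subTy σ ∘ lookup Γ →
    lookup (map (renTy suc) Δ) ≗ subTy (extsTy σ) ∘ lookup (map (renTy suc) Γ)
  lookup-map-renTy-suc-subTy {Γ = Γ} {Δ = Δ} {σ} h i = begin
    lookup (map (renTy suc) Δ) i                   ≡⟨ lookup-map i (renTy suc) Δ ⟩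
    renTy suc (lookup Δ i)                         ≡⟨ cong (renTy suc) (h i) ⟩
    renTy suc (subTy σ (lookup Γ i))               ≡⟨ renTy-suc-subTy σ (lookup Γ i) ⟩
    subTy (extsTy σ) (renTy suc (lookup Γ i))      ≡⟨ cong (subTy (extsTy σ)) (lookup-map i (renTy suc) Γ) ⟨
    subTy (extsTy σ) (lookup (map (renTy suc) Γ) i) ∎

  ⊢subTyTm : {Δ : Ctx n' m} {σ : Fin n → Ty n'} {t : Tm n m} {A : Ty n} →
             lookup Δ ≗ subTy σ ∘ lookup Γ → Γ ⊢ t ∶ A → Δ ⊢ subTyTm σ t ∶ subTy σ A
  ⊢subTyTm {Δ = Δ} h (⊢var {x = x}) = subst (Δ ⊢ var x ∶_) (h x) ⊢var
  ⊢subTyTm h (⊢⊞ ⊢t ⊢u)     = ⊢⊞ (⊢subTyTm h ⊢t) (⊢subTyTm h ⊢u)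
  ⊢subTyTm h (⊢• ⊢t)        = ⊢• (⊢subTyTm h ⊢t)
  ⊢subTyTm h ⊢⋆             = ⊢⋆
  ⊢subTyTm h (⊢δ𝟏 ⊢t ⊢u)    = ⊢δ𝟏 (⊢subTyTm h ⊢t) (⊢subTyTm h ⊢u)
  ⊢subTyTm h (⊢ƛ ⊢t)        = ⊢ƛ (⊢subTyTm (lookup-∷-subTy h) ⊢t)
  ⊢subTyTm h (⊢· ⊢t ⊢u)     = ⊢· (⊢subTyTm h ⊢t) (⊢subTyTm h ⊢u)
  ⊢subTyTm h (⊢⊗ ⊢t ⊢u)     = ⊢⊗ (⊢subTyTm h ⊢t) (⊢subTyTm h ⊢u)
  ⊢subTyTm h (⊢δ⊗ ⊢t ⊢u)    = ⊢δ⊗ (⊢subTyTm h ⊢t) (⊢subTyTm (lookup-∷-subTy (lookup-∷-subTy h)) ⊢u)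
  ⊢subTyTm h ⊢⟨⟩            = ⊢⟨⟩
  ⊢subTyTm h (⊢δ𝟎 ⊢t)       = ⊢δ𝟎 (⊢subTyTm h ⊢t)
  ⊢subTyTm h (⊢⟨,⟩ ⊢t ⊢u)   = ⊢⟨,⟩ (⊢subTyTm h ⊢t) (⊢subTyTm h ⊢u)
  ⊢subTyTm h (⊢δ&₁ ⊢t ⊢u)   = ⊢δ&₁ (⊢subTyTm h ⊢t) (⊢subTyTm (lookup-∷-subTy h) ⊢u)
  ⊢subTyTm h (⊢δ&₂ ⊢t ⊢u)   = ⊢δ&₂ (⊢subTyTm h ⊢t) (⊢subTyTm (lookup-∷-subTy h) ⊢u)
  ⊢subTyTm h (⊢inl ⊢t)      = ⊢inl (⊢subTyTm h ⊢t)
  ⊢subTyTm h (⊢inr ⊢t)      = ⊢inr (⊢subTyTm h ⊢t)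
  ⊢subTyTm h (⊢δ⊕ ⊢t ⊢v ⊢w) =
    ⊢δ⊕ (⊢subTyTm h ⊢t) (⊢subTyTm (lookup-∷-subTy h) ⊢v) (⊢subTyTm (lookup-∷-subTy h) ⊢w)
  ⊢subTyTm h (⊢! ⊢t)        = ⊢! (⊢subTyTm h ⊢t)
  ⊢subTyTm h (⊢δ! ⊢t ⊢u)    = ⊢δ! (⊢subTyTm h ⊢t) (⊢subTyTm (lookup-∷-subTy h) ⊢u)
  ⊢subTyTm {Γ = Γ} {Δ = Δ} h (⊢Λ ⊢t) = ⊢Λ (⊢subTyTm (lookup-map-renTy-suc-subTy {Γ = Γ} {Δ = Δ} h) ⊢t)
  ⊢subTyTm {Δ = Δ} {σ} h (⊢·ᵀ {A = A} {B} {t} ⊢t) =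
    subst (Δ ⊢ subTyTm σ t ·ᵀ subTy σ B ∶_) (sym (subTy-[]ₜ σ A B)) (⊢·ᵀ (⊢subTyTm h ⊢t))

  ⊢wkTyTm : {t : Tm n m} {A : Ty n} → Γ ⊢ t ∶ A → map (renTy suc) Γ ⊢ wkTyTm t ∶ renTy suc A
  ⊢wkTyTm {Γ = Γ} {A = A} ⊢t =
    subst (map (renTy suc) Γ ⊢ _ ∶_) (sym (renTy≗subTy (λ _ → refl) A)) (⊢subTyTm lookup-wk ⊢t)
    where
    lookup-wk : lookup (map (renTy suc) Γ) ≗ subTy (`_ ∘ suc) ∘ lookup Γ
    lookup-wk i = trans (lookup-map i (renTy suc) Γ) (renTy≗subTy (λ _ → refl) (lookup Γ i))

  ⊢[]ᵀ : {t : Tm (suc n) m} {A : Ty (suc n)} (B : Ty n) →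
         map (renTy suc) Γ ⊢ t ∶ A → Γ ⊢ t [ B ]ᵀ ∶ A [ B ]ₜ
  ⊢[]ᵀ {Γ = Γ} B = ⊢subTyTm lookup-σ₀
    where
    lookup-σ₀ : lookup Γ ≗ subTy (σ₀ B) ∘ lookup (map (renTy suc) Γ)
    lookup-σ₀ i =
      sym (trans (cong (subTy (σ₀ B)) (lookup-map i (renTy suc) Γ)) (renTy-suc-[]ₜ (lookup Γ i) B))

  ⊢extsTm : {Δ : Ctx n m'} {σ : Fin m → Tm n m'} {A : Ty n} →
            (∀ i → Δ ⊢ σ i ∶ lookup Γ i) → ∀ i → A ∷ Δ ⊢ extsTm σ i ∶ lookup (A ∷ Γ) i
  ⊢extsTm h zero    = ⊢var
  ⊢extsTm h (suc i) = ⊢renTm (λ _ → refl) (h i)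

  ⊢subTm : {Δ : Ctx n m'} {σ : Fin m → Tm n m'} {t : Tm n m} {A : Ty n} →
           (∀ i → Δ ⊢ σ i ∶ lookup Γ i) → Γ ⊢ t ∶ A → Δ ⊢ subTm σ t ∶ A
  ⊢subTm h (⊢var {x = x})   = h x
  ⊢subTm h (⊢⊞ ⊢t ⊢u)     = ⊢⊞ (⊢subTm h ⊢t) (⊢subTm h ⊢u)
  ⊢subTm h (⊢• ⊢t)        = ⊢• (⊢subTm h ⊢t)
  ⊢subTm h ⊢⋆             = ⊢⋆
  ⊢subTm h (⊢δ𝟏 ⊢t ⊢u)    = ⊢δ𝟏 (⊢subTm h ⊢t) (⊢subTm h ⊢u)
  ⊢subTm h (⊢ƛ ⊢t)        = ⊢ƛ (⊢subTm (⊢extsTm h) ⊢t)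
  ⊢subTm h (⊢· ⊢t ⊢u)     = ⊢· (⊢subTm h ⊢t) (⊢subTm h ⊢u)
  ⊢subTm h (⊢⊗ ⊢t ⊢u)     = ⊢⊗ (⊢subTm h ⊢t) (⊢subTm h ⊢u)
  ⊢subTm h (⊢δ⊗ ⊢t ⊢u)    = ⊢δ⊗ (⊢subTm h ⊢t) (⊢subTm (⊢extsTm (⊢extsTm h)) ⊢u)
  ⊢subTm h ⊢⟨⟩            = ⊢⟨⟩
  ⊢subTm h (⊢δ𝟎 ⊢t)       = ⊢δ𝟎 (⊢subTm h ⊢t)
  ⊢subTm h (⊢⟨,⟩ ⊢t ⊢u)   = ⊢⟨,⟩ (⊢subTm h ⊢t) (⊢subTm h ⊢u)
  ⊢subTm h (⊢δ&₁ ⊢t ⊢u)   = ⊢δ&₁ (⊢subTm h ⊢t) (⊢subTm (⊢extsTm h) ⊢u)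
  ⊢subTm h (⊢δ&₂ ⊢t ⊢u)   = ⊢δ&₂ (⊢subTm h ⊢t) (⊢subTm (⊢extsTm h) ⊢u)
  ⊢subTm h (⊢inl ⊢t)      = ⊢inl (⊢subTm h ⊢t)
  ⊢subTm h (⊢inr ⊢t)      = ⊢inr (⊢subTm h ⊢t)
  ⊢subTm h (⊢δ⊕ ⊢t ⊢v ⊢w) = ⊢δ⊕ (⊢subTm h ⊢t) (⊢subTm (⊢extsTm h) ⊢v) (⊢subTm (⊢extsTm h) ⊢w)
  ⊢subTm h (⊢! ⊢t)        = ⊢! (⊢subTm h ⊢t)
  ⊢subTm h (⊢δ! ⊢t ⊢u)    = ⊢δ! (⊢subTm h ⊢t) (⊢subTm (⊢extsTm h) ⊢u)
  ⊢subTm {Γ = Γ} {Δ = Δ} {σ} h (⊢Λ ⊢t) = ⊢Λ (⊢subTm ⊢wk-σ ⊢t)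
    where
    ⊢wk-σ : ∀ i → map (renTy suc) Δ ⊢ wkTyTm (σ i) ∶ lookup (map (renTy suc) Γ) i
    ⊢wk-σ i = subst (map (renTy suc) Δ ⊢ wkTyTm (σ i) ∶_) (sym (lookup-map i (renTy suc) Γ)) (⊢wkTyTm (h i))
  ⊢subTm h (⊢·ᵀ ⊢t)       = ⊢·ᵀ (⊢subTm h ⊢t)

  ⊢[] : {t : Tm n (suc m)} {u : Tm n m} {A B : Ty n} → A ∷ Γ ⊢ t ∶ B → Γ ⊢ u ∶ A → Γ ⊢ t [ u ] ∶ B
  ⊢[] ⊢t ⊢u = ⊢subTm ⊢ς₁ ⊢t
    where
    ⊢ς₁ : ∀ i → _ ⊢ ς₁ _ i ∶ lookup (_ ∷ _) i
    ⊢ς₁ zero    = ⊢u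
    ⊢ς₁ (suc i) = ⊢var

  ⊢[,] : {w : Tm n (suc (suc m))} {u v : Tm n m} {A B C : Ty n} →
         B ∷ A ∷ Γ ⊢ w ∶ C → Γ ⊢ u ∶ A → Γ ⊢ v ∶ B → Γ ⊢ w [ u , v ] ∶ C
  ⊢[,] ⊢w ⊢u ⊢v = ⊢subTm ⊢ς₂ ⊢w
    where
    ⊢ς₂ : ∀ i → _ ⊢ ς₂ _ _ i ∶ lookup (_ ∷ _ ∷ _) i
    ⊢ς₂ zero          = ⊢v
    ⊢ς₂ (suc zero)    = ⊢u
    ⊢ς₂ (suc (suc i)) = ⊢var

  -- Parallel reduction

  private variable
    x y : Carrier
    A' B' : Ty n
    t t' u u' v v' w w' : Tm n m

  infix 4 _⇒_
  data _⇒_ : Tm n m → Tm n m → Set ℓ₁ where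
    pvar : {i : Fin m} → var {n} i ⇒ var i
    p⊞   : t ⇒ t' → u ⇒ u' → t ⊞ u ⇒ t' ⊞ u'
    p•   : t ⇒ t' → x • t ⇒ x • t'
    p⋆   : _∙⋆ {n} {m} x ⇒ x ∙⋆
    pδ𝟏  : t ⇒ t' → u ⇒ u' → δ𝟏 t u ⇒ δ𝟏 t' u'
    pƛ   : {t t' : Tm n (suc m)} → t ⇒ t' → ƛ A' t ⇒ ƛ A' t'
    p·   : t ⇒ t' → u ⇒ u' → t · u ⇒ t' · u'
    p⊗   : t ⇒ t' → u ⇒ u' → t ⊗ₜ u ⇒ t' ⊗ₜ u'
    pδ⊗  : {t t' : Tm n m} {u u' : Tm n (suc (suc m))} → t ⇒ t' → u ⇒ u' →
           δ⊗ t A' B' u ⇒ δ⊗ t' A' B' u'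
    p⟨⟩  : ⟨⟩ {n} {m} ⇒ ⟨⟩
    pδ𝟎  : t ⇒ t' → δ𝟎 t ⇒ δ𝟎 t'
    p⟨,⟩ : t ⇒ t' → u ⇒ u' → ⟨ t , u ⟩ ⇒ ⟨ t' , u' ⟩
    pδ&₁ : {t t' : Tm n m} {u u' : Tm n (suc m)} → t ⇒ t' → u ⇒ u' → δ&₁ t A' u ⇒ δ&₁ t' A' u'
    pδ&₂ : {t t' : Tm n m} {u u' : Tm n (suc m)} → t ⇒ t' → u ⇒ u' → δ&₂ t A' u ⇒ δ&₂ t' A' u'
    pinl : t ⇒ t' → inl t ⇒ inl t'
    pinr : t ⇒ t' → inr t ⇒ inr t'
    pδ⊕  : {t t' : Tm n m} {v v' w w' : Tm n (suc m)} → t ⇒ t' → v ⇒ v' → w ⇒ w' →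
           δ⊕ t A' v B' w ⇒ δ⊕ t' A' v' B' w'
    p!   : t ⇒ t' → ! t ⇒ ! t'
    pδ!  : {t t' : Tm n m} {u u' : Tm n (suc m)} → t ⇒ t' → u ⇒ u' → δ! t A' u ⇒ δ! t' A' u'
    pΛ   : {t t' : Tm (suc n) m} → t ⇒ t' → Λ t ⇒ Λ t'
    p·ᵀ  : t ⇒ t' → t ·ᵀ A' ⇒ t' ·ᵀ A'
    pβ𝟏  : u ⇒ u' → δ𝟏 (x ∙⋆) u ⇒ x • u'
    pβ⊸  : {t t' : Tm n (suc m)} {u u' : Tm n m} → t ⇒ t' → u ⇒ u' → ƛ A' t · u ⇒ t' [ u' ]
    pβ⊗  : {u u' v v' : Tm n m} {w w' : Tm n (suc (suc m))} → u ⇒ u' → v ⇒ v' → w ⇒ w' →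
           δ⊗ (u ⊗ₜ v) A' B' w ⇒ w' [ u' , v' ]
    pβ&₁ : {t t' u : Tm n m} {v v' : Tm n (suc m)} → t ⇒ t' → v ⇒ v' →
           δ&₁ ⟨ t , u ⟩ A' v ⇒ v' [ t' ]
    pβ&₂ : {t u u' : Tm n m} {v v' : Tm n (suc m)} → u ⇒ u' → v ⇒ v' →
           δ&₂ ⟨ t , u ⟩ A' v ⇒ v' [ u' ]
    pβ⊕₁ : {t t' : Tm n m} {v v' w : Tm n (suc m)} → t ⇒ t' → v ⇒ v' →
           δ⊕ (inl t) A' v B' w ⇒ v' [ t' ]
    pβ⊕₂ : {t t' : Tm n m} {v w w' : Tm n (suc m)} → t ⇒ t' → w ⇒ w' →
           δ⊕ (inr t) A' v B' w ⇒ w' [ t' ]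
    pβ!  : {t t' : Tm n m} {u u' : Tm n (suc m)} → t ⇒ t' → u ⇒ u' → δ! (! t) A' u ⇒ u' [ t' ]
    pβ∀  : {t t' : Tm (suc n) m} → t ⇒ t' → Λ t ·ᵀ A' ⇒ t' [ A' ]ᵀ
    p⊞𝟏  : (_∙⋆ {n} {m} x) ⊞ (y ∙⋆) ⇒ (x +ₛ y) ∙⋆
    p⊞⊸  : {t t' u u' : Tm n (suc m)} → t ⇒ t' → u ⇒ u' → ƛ A' t ⊞ ƛ A' u ⇒ ƛ A' (t' ⊞ u')
    p⊞⊗  : {t t' u u' : Tm n m} {v v' : Tm n (suc (suc m))} → t ⇒ t' → u ⇒ u' → v ⇒ v' →
           δ⊗ (t ⊞ u) A' B' v ⇒ δ⊗ t' A' B' v' ⊞ δ⊗ u' A' B' v'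
    p⊞⊤  : ⟨⟩ {n} {m} ⊞ ⟨⟩ ⇒ ⟨⟩
    p⊞&  : t ⇒ t' → u ⇒ u' → v ⇒ v' → w ⇒ w' → ⟨ t , u ⟩ ⊞ ⟨ v , w ⟩ ⇒ ⟨ t' ⊞ v' , u' ⊞ w' ⟩
    p⊞⊕  : {t t' u u' : Tm n m} {v v' w w' : Tm n (suc m)} → t ⇒ t' → u ⇒ u' → v ⇒ v' → w ⇒ w' →
           δ⊕ (t ⊞ u) A' v B' w ⇒ δ⊕ t' A' v' B' w' ⊞ δ⊕ u' A' v' B' w'
    p⊞!  : t ⇒ t' → u ⇒ u' → ! t ⊞ ! u ⇒ ! (t' ⊞ u')
    p⊞∀  : {t t' u u' : Tm (suc n) m} → t ⇒ t' → u ⇒ u' → Λ t ⊞ Λ u ⇒ Λ (t' ⊞ u')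
    p•𝟏  : x • (_∙⋆ {n} {m} y) ⇒ (x *ₛ y) ∙⋆
    p•⊸  : {t t' : Tm n (suc m)} → t ⇒ t' → x • ƛ A' t ⇒ ƛ A' (x • t')
    p•⊗  : {t t' : Tm n m} {v v' : Tm n (suc (suc m))} → t ⇒ t' → v ⇒ v' →
           δ⊗ (x • t) A' B' v ⇒ x • δ⊗ t' A' B' v'
    p•⊤  : x • ⟨⟩ {n} {m} ⇒ ⟨⟩
    p•&  : t ⇒ t' → u ⇒ u' → x • ⟨ t , u ⟩ ⇒ ⟨ x • t' , x • u' ⟩
    p•⊕  : {t t' : Tm n m} {v v' w w' : Tm n (suc m)} → t ⇒ t' → v ⇒ v' → w ⇒ w' →
           δ⊕ (x • t) A' v B' w ⇒ x • δ⊕ t' A' v' B' w'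
    p•!  : t ⇒ t' → x • ! t ⇒ ! (x • t')
    p•∀  : {t t' : Tm (suc n) m} → t ⇒ t' → x • Λ t ⇒ Λ (x • t')

  ⇒-refl : (t : Tm n m) → t ⇒ t
  ⇒-refl (var i)        = pvar
  ⇒-refl (t ⊞ u)        = p⊞ (⇒-refl t) (⇒-refl u)
  ⇒-refl (x • t)        = p• (⇒-refl t)
  ⇒-refl (x ∙⋆)         = p⋆
  ⇒-refl (δ𝟏 t u)       = pδ𝟏 (⇒-refl t) (⇒-refl u)
  ⇒-refl (ƛ A t)        = pƛ (⇒-refl t)
  ⇒-refl (t · u)        = p· (⇒-refl t) (⇒-refl u)
  ⇒-refl (t ⊗ₜ u)       = p⊗ (⇒-refl t) (⇒-refl u)
  ⇒-refl (δ⊗ t A B u)   = pδ⊗ (⇒-refl t) (⇒-refl u)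
  ⇒-refl ⟨⟩             = p⟨⟩
  ⇒-refl (δ𝟎 t)         = pδ𝟎 (⇒-refl t)
  ⇒-refl ⟨ t , u ⟩      = p⟨,⟩ (⇒-refl t) (⇒-refl u)
  ⇒-refl (δ&₁ t A u)    = pδ&₁ (⇒-refl t) (⇒-refl u)
  ⇒-refl (δ&₂ t A u)    = pδ&₂ (⇒-refl t) (⇒-refl u)
  ⇒-refl (inl t)        = pinl (⇒-refl t)
  ⇒-refl (inr t)        = pinr (⇒-refl t)
  ⇒-refl (δ⊕ t A v B w) = pδ⊕ (⇒-refl t) (⇒-refl v) (⇒-refl w)
  ⇒-refl (! t)          = p! (⇒-refl t)
  ⇒-refl (δ! t A u)     = pδ! (⇒-refl t) (⇒-refl u)
  ⇒-refl (Λ t)          = pΛ (⇒-refl t)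
  ⇒-refl (t ·ᵀ A)       = p·ᵀ (⇒-refl t)

  ⟶⊆⇒ : t ⟶ u → t ⇒ u
  ⟶⊆⇒ β𝟏        = pβ𝟏 (⇒-refl _)
  ⟶⊆⇒ β⊸        = pβ⊸ (⇒-refl _) (⇒-refl _)
  ⟶⊆⇒ β⊗        = pβ⊗ (⇒-refl _) (⇒-refl _) (⇒-refl _)
  ⟶⊆⇒ β&₁       = pβ&₁ (⇒-refl _) (⇒-refl _)
  ⟶⊆⇒ β&₂       = pβ&₂ (⇒-refl _) (⇒-refl _)
  ⟶⊆⇒ β⊕₁       = pβ⊕₁ (⇒-refl _) (⇒-refl _)
  ⟶⊆⇒ β⊕₂       = pβ⊕₂ (⇒-refl _) (⇒-refl _)
  ⟶⊆⇒ β!        = pβ! (⇒-refl _) (⇒-refl _)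
  ⟶⊆⇒ β∀        = pβ∀ (⇒-refl _)
  ⟶⊆⇒ ⊞𝟏        = p⊞𝟏
  ⟶⊆⇒ ⊞⊸        = p⊞⊸ (⇒-refl _) (⇒-refl _)
  ⟶⊆⇒ ⊞⊗        = p⊞⊗ (⇒-refl _) (⇒-refl _) (⇒-refl _)
  ⟶⊆⇒ ⊞⊤        = p⊞⊤
  ⟶⊆⇒ ⊞&        = p⊞& (⇒-refl _) (⇒-refl _) (⇒-refl _) (⇒-refl _)
  ⟶⊆⇒ ⊞⊕        = p⊞⊕ (⇒-refl _) (⇒-refl _) (⇒-refl _) (⇒-refl _)
  ⟶⊆⇒ ⊞!        = p⊞! (⇒-refl _) (⇒-refl _)
  ⟶⊆⇒ ⊞∀        = p⊞∀ (⇒-refl _) (⇒-refl _)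
  ⟶⊆⇒ •𝟏        = p•𝟏
  ⟶⊆⇒ •⊸        = p•⊸ (⇒-refl _)
  ⟶⊆⇒ •⊗        = p•⊗ (⇒-refl _) (⇒-refl _)
  ⟶⊆⇒ •⊤        = p•⊤
  ⟶⊆⇒ •&        = p•& (⇒-refl _) (⇒-refl _)
  ⟶⊆⇒ •⊕        = p•⊕ (⇒-refl _) (⇒-refl _) (⇒-refl _)
  ⟶⊆⇒ •!        = p•! (⇒-refl _)
  ⟶⊆⇒ •∀        = p•∀ (⇒-refl _)
  ⟶⊆⇒ (ξ⊞ₗ r)   = p⊞ (⟶⊆⇒ r) (⇒-refl _)
  ⟶⊆⇒ (ξ⊞ᵣ r)   = p⊞ (⇒-refl _) (⟶⊆⇒ r)
  ⟶⊆⇒ (ξ• r)    = p• (⟶⊆⇒ r)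
  ⟶⊆⇒ (ξδ𝟏ₗ r)  = pδ𝟏 (⟶⊆⇒ r) (⇒-refl _)
  ⟶⊆⇒ (ξδ𝟏ᵣ r)  = pδ𝟏 (⇒-refl _) (⟶⊆⇒ r)
  ⟶⊆⇒ (ξƛ r)    = pƛ (⟶⊆⇒ r)
  ⟶⊆⇒ (ξ·ₗ r)   = p· (⟶⊆⇒ r) (⇒-refl _)
  ⟶⊆⇒ (ξ·ᵣ r)   = p· (⇒-refl _) (⟶⊆⇒ r)
  ⟶⊆⇒ (ξ⊗ₗ r)   = p⊗ (⟶⊆⇒ r) (⇒-refl _)
  ⟶⊆⇒ (ξ⊗ᵣ r)   = p⊗ (⇒-refl _) (⟶⊆⇒ r)
  ⟶⊆⇒ (ξδ⊗ₗ r)  = pδ⊗ (⟶⊆⇒ r) (⇒-refl _)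
  ⟶⊆⇒ (ξδ⊗ᵣ r)  = pδ⊗ (⇒-refl _) (⟶⊆⇒ r)
  ⟶⊆⇒ (ξδ𝟎 r)   = pδ𝟎 (⟶⊆⇒ r)
  ⟶⊆⇒ (ξ&ₗ r)   = p⟨,⟩ (⟶⊆⇒ r) (⇒-refl _)
  ⟶⊆⇒ (ξ&ᵣ r)   = p⟨,⟩ (⇒-refl _) (⟶⊆⇒ r)
  ⟶⊆⇒ (ξδ&₁ₗ r) = pδ&₁ (⟶⊆⇒ r) (⇒-refl _)
  ⟶⊆⇒ (ξδ&₁ᵣ r) = pδ&₁ (⇒-refl _) (⟶⊆⇒ r)
  ⟶⊆⇒ (ξδ&₂ₗ r) = pδ&₂ (⟶⊆⇒ r) (⇒-refl _)
  ⟶⊆⇒ (ξδ&₂ᵣ r) = pδ&₂ (⇒-refl _) (⟶⊆⇒ r)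
  ⟶⊆⇒ (ξinl r)  = pinl (⟶⊆⇒ r)
  ⟶⊆⇒ (ξinr r)  = pinr (⟶⊆⇒ r)
  ⟶⊆⇒ (ξδ⊕₁ r)  = pδ⊕ (⟶⊆⇒ r) (⇒-refl _) (⇒-refl _)
  ⟶⊆⇒ (ξδ⊕₂ r)  = pδ⊕ (⇒-refl _) (⟶⊆⇒ r) (⇒-refl _)
  ⟶⊆⇒ (ξδ⊕₃ r)  = pδ⊕ (⇒-refl _) (⇒-refl _) (⟶⊆⇒ r)
  ⟶⊆⇒ (ξ! r)    = p! (⟶⊆⇒ r)
  ⟶⊆⇒ (ξδ!ₗ r)  = pδ! (⟶⊆⇒ r) (⇒-refl _)
  ⟶⊆⇒ (ξδ!ᵣ r)  = pδ! (⇒-refl _) (⟶⊆⇒ r)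
  ⟶⊆⇒ (ξΛ r)    = pΛ (⟶⊆⇒ r)
  ⟶⊆⇒ (ξ·ᵀ r)   = p·ᵀ (⟶⊆⇒ r)

  ⊞* : t ⟶* t' → u ⟶* u' → t ⊞ u ⟶* t' ⊞ u'
  ⊞* = star-cong₂ _⊞_ ξ⊞ₗ ξ⊞ᵣ

  •* : t ⟶* t' → x • t ⟶* x • t'
  •* = gmap _ ξ•

  δ𝟏* : t ⟶* t' → u ⟶* u' → δ𝟏 t u ⟶* δ𝟏 t' u'
  δ𝟏* = star-cong₂ δ𝟏 ξδ𝟏ₗ ξδ𝟏ᵣ

  ƛ* : {t t' : Tm n (suc m)} → t ⟶* t' → ƛ A' t ⟶* ƛ A' t'
  ƛ* = gmap _ ξƛ

  ·* : t ⟶* t' → u ⟶* u' → t · u ⟶* t' · u'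
  ·* = star-cong₂ _·_ ξ·ₗ ξ·ᵣ

  ⊗* : t ⟶* t' → u ⟶* u' → t ⊗ₜ u ⟶* t' ⊗ₜ u'
  ⊗* = star-cong₂ _⊗ₜ_ ξ⊗ₗ ξ⊗ᵣ

  δ⊗* : {t t' : Tm n m} {u u' : Tm n (suc (suc m))} → t ⟶* t' → u ⟶* u' →
        δ⊗ t A' B' u ⟶* δ⊗ t' A' B' u'
  δ⊗* = star-cong₂ (λ t u → δ⊗ t _ _ u) ξδ⊗ₗ ξδ⊗ᵣ

  δ𝟎* : t ⟶* t' → δ𝟎 t ⟶* δ𝟎 t'
  δ𝟎* = gmap _ ξδ𝟎

  ⟨,⟩* : t ⟶* t' → u ⟶* u' → ⟨ t , u ⟩ ⟶* ⟨ t' , u' ⟩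
  ⟨,⟩* = star-cong₂ ⟨_,_⟩ ξ&ₗ ξ&ᵣ

  δ&₁* : {t t' : Tm n m} {u u' : Tm n (suc m)} → t ⟶* t' → u ⟶* u' → δ&₁ t A' u ⟶* δ&₁ t' A' u'
  δ&₁* = star-cong₂ (λ t u → δ&₁ t _ u) ξδ&₁ₗ ξδ&₁ᵣ

  δ&₂* : {t t' : Tm n m} {u u' : Tm n (suc m)} → t ⟶* t' → u ⟶* u' → δ&₂ t A' u ⟶* δ&₂ t' A' u'
  δ&₂* = star-cong₂ (λ t u → δ&₂ t _ u) ξδ&₂ₗ ξδ&₂ᵣ

  inl* : t ⟶* t' → inl t ⟶* inl t'
  inl* = gmap _ ξinl

  inr* : t ⟶* t' → inr t ⟶* inr t'
  inr* = gmap _ ξinr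

  δ⊕* : {t t' : Tm n m} {v v' w w' : Tm n (suc m)} → t ⟶* t' → v ⟶* v' → w ⟶* w' →
        δ⊕ t A' v B' w ⟶* δ⊕ t' A' v' B' w'
  δ⊕* = star-cong₃ (λ t v w → δ⊕ t _ v _ w) ξδ⊕₁ ξδ⊕₂ ξδ⊕₃

  !* : t ⟶* t' → ! t ⟶* ! t'
  !* = gmap _ ξ!

  δ!* : {t t' : Tm n m} {u u' : Tm n (suc m)} → t ⟶* t' → u ⟶* u' → δ! t A' u ⟶* δ! t' A' u'
  δ!* = star-cong₂ (λ t u → δ! t _ u) ξδ!ₗ ξδ!ᵣ

  Λ* : {t t' : Tm (suc n) m} → t ⟶* t' → Λ t ⟶* Λ t'
  Λ* = gmap _ ξΛ

  ·ᵀ* : t ⟶* t' → t ·ᵀ A' ⟶* t' ·ᵀ A'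
  ·ᵀ* = gmap _ ξ·ᵀ

  _▻_ : t ⟶* u → u ⟶ v → t ⟶* v
  rs ▻ r = rs ◅◅ r ◅ ε

  ⇒⊆⟶* : t ⇒ u → t ⟶* u
  ⇒⊆⟶* pvar              = ε
  ⇒⊆⟶* (p⊞ d e)          = ⊞* (⇒⊆⟶* d) (⇒⊆⟶* e)
  ⇒⊆⟶* (p• d)            = •* (⇒⊆⟶* d)
  ⇒⊆⟶* p⋆                = ε
  ⇒⊆⟶* (pδ𝟏 d e)         = δ𝟏* (⇒⊆⟶* d) (⇒⊆⟶* e)
  ⇒⊆⟶* (pƛ d)            = ƛ* (⇒⊆⟶* d)
  ⇒⊆⟶* (p· d e)          = ·* (⇒⊆⟶* d) (⇒⊆⟶* e)
  ⇒⊆⟶* (p⊗ d e)          = ⊗* (⇒⊆⟶* d) (⇒⊆⟶* e)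
  ⇒⊆⟶* (pδ⊗ d e)         = δ⊗* (⇒⊆⟶* d) (⇒⊆⟶* e)
  ⇒⊆⟶* p⟨⟩               = ε
  ⇒⊆⟶* (pδ𝟎 d)           = δ𝟎* (⇒⊆⟶* d)
  ⇒⊆⟶* (p⟨,⟩ d e)        = ⟨,⟩* (⇒⊆⟶* d) (⇒⊆⟶* e)
  ⇒⊆⟶* (pδ&₁ d e)        = δ&₁* (⇒⊆⟶* d) (⇒⊆⟶* e)
  ⇒⊆⟶* (pδ&₂ d e)        = δ&₂* (⇒⊆⟶* d) (⇒⊆⟶* e)
  ⇒⊆⟶* (pinl d)          = inl* (⇒⊆⟶* d)
  ⇒⊆⟶* (pinr d)          = inr* (⇒⊆⟶* d)
  ⇒⊆⟶* (pδ⊕ d e f)       = δ⊕* (⇒⊆⟶* d) (⇒⊆⟶* e) (⇒⊆⟶* f)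
  ⇒⊆⟶* (p! d)            = !* (⇒⊆⟶* d)
  ⇒⊆⟶* (pδ! d e)         = δ!* (⇒⊆⟶* d) (⇒⊆⟶* e)
  ⇒⊆⟶* (pΛ d)            = Λ* (⇒⊆⟶* d)
  ⇒⊆⟶* (p·ᵀ d)           = ·ᵀ* (⇒⊆⟶* d)
  ⇒⊆⟶* (pβ𝟏 d)           = δ𝟏* ε (⇒⊆⟶* d) ▻ β𝟏
  ⇒⊆⟶* (pβ⊸ d e)         = ·* (ƛ* (⇒⊆⟶* d)) (⇒⊆⟶* e) ▻ β⊸
  ⇒⊆⟶* (pβ⊗ d e f)       = δ⊗* (⊗* (⇒⊆⟶* d) (⇒⊆⟶* e)) (⇒⊆⟶* f) ▻ β⊗
  ⇒⊆⟶* (pβ&₁ d e)        = δ&₁* (⟨,⟩* (⇒⊆⟶* d) ε) (⇒⊆⟶* e) ▻ β&₁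
  ⇒⊆⟶* (pβ&₂ d e)        = δ&₂* (⟨,⟩* ε (⇒⊆⟶* d)) (⇒⊆⟶* e) ▻ β&₂
  ⇒⊆⟶* (pβ⊕₁ d e)        = δ⊕* (inl* (⇒⊆⟶* d)) (⇒⊆⟶* e) ε ▻ β⊕₁
  ⇒⊆⟶* (pβ⊕₂ d e)        = δ⊕* (inr* (⇒⊆⟶* d)) ε (⇒⊆⟶* e) ▻ β⊕₂
  ⇒⊆⟶* (pβ! d e)         = δ!* (!* (⇒⊆⟶* d)) (⇒⊆⟶* e) ▻ β!
  ⇒⊆⟶* (pβ∀ d)           = ·ᵀ* (Λ* (⇒⊆⟶* d)) ▻ β∀
  ⇒⊆⟶* p⊞𝟏               = ε ▻ ⊞𝟏
  ⇒⊆⟶* (p⊞⊸ d e)         = ⊞* (ƛ* (⇒⊆⟶* d)) (ƛ* (⇒⊆⟶* e)) ▻ ⊞⊸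
  ⇒⊆⟶* (p⊞⊗ d e f)       = δ⊗* (⊞* (⇒⊆⟶* d) (⇒⊆⟶* e)) (⇒⊆⟶* f) ▻ ⊞⊗
  ⇒⊆⟶* p⊞⊤               = ε ▻ ⊞⊤
  ⇒⊆⟶* (p⊞& d e f g)     = ⊞* (⟨,⟩* (⇒⊆⟶* d) (⇒⊆⟶* e)) (⟨,⟩* (⇒⊆⟶* f) (⇒⊆⟶* g)) ▻ ⊞&
  ⇒⊆⟶* (p⊞⊕ d e f g)     = δ⊕* (⊞* (⇒⊆⟶* d) (⇒⊆⟶* e)) (⇒⊆⟶* f) (⇒⊆⟶* g) ▻ ⊞⊕
  ⇒⊆⟶* (p⊞! d e)         = ⊞* (!* (⇒⊆⟶* d)) (!* (⇒⊆⟶* e)) ▻ ⊞!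
  ⇒⊆⟶* (p⊞∀ d e)         = ⊞* (Λ* (⇒⊆⟶* d)) (Λ* (⇒⊆⟶* e)) ▻ ⊞∀
  ⇒⊆⟶* p•𝟏               = ε ▻ •𝟏
  ⇒⊆⟶* (p•⊸ d)           = •* (ƛ* (⇒⊆⟶* d)) ▻ •⊸
  ⇒⊆⟶* (p•⊗ d e)         = δ⊗* (•* (⇒⊆⟶* d)) (⇒⊆⟶* e) ▻ •⊗
  ⇒⊆⟶* p•⊤               = ε ▻ •⊤
  ⇒⊆⟶* (p•& d e)         = •* (⟨,⟩* (⇒⊆⟶* d) (⇒⊆⟶* e)) ▻ •&
  ⇒⊆⟶* (p•⊕ d e f)       = δ⊕* (•* (⇒⊆⟶* d)) (⇒⊆⟶* e) (⇒⊆⟶* f) ▻ •⊕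
  ⇒⊆⟶* (p•! d)           = •* (!* (⇒⊆⟶* d)) ▻ •!
  ⇒⊆⟶* (p•∀ d)           = •* (Λ* (⇒⊆⟶* d)) ▻ •∀

  ⇒-renTm : (ρ : Fin m → Fin m') → t ⇒ t' → renTm ρ t ⇒ renTm ρ t'
  ⇒-renTm ρ pvar              = pvar
  ⇒-renTm ρ (p⊞ d e)          = p⊞ (⇒-renTm ρ d) (⇒-renTm ρ e)
  ⇒-renTm ρ (p• d)            = p• (⇒-renTm ρ d)
  ⇒-renTm ρ p⋆                = p⋆
  ⇒-renTm ρ (pδ𝟏 d e)         = pδ𝟏 (⇒-renTm ρ d) (⇒-renTm ρ e)
  ⇒-renTm ρ (pƛ d)            = pƛ (⇒-renTm (extR ρ) d)
  ⇒-renTm ρ (p· d e)          = p· (⇒-renTm ρ d) (⇒-renTm ρ e)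
  ⇒-renTm ρ (p⊗ d e)          = p⊗ (⇒-renTm ρ d) (⇒-renTm ρ e)
  ⇒-renTm ρ (pδ⊗ d e)         = pδ⊗ (⇒-renTm ρ d) (⇒-renTm (extR (extR ρ)) e)
  ⇒-renTm ρ p⟨⟩               = p⟨⟩
  ⇒-renTm ρ (pδ𝟎 d)           = pδ𝟎 (⇒-renTm ρ d)
  ⇒-renTm ρ (p⟨,⟩ d e)        = p⟨,⟩ (⇒-renTm ρ d) (⇒-renTm ρ e)
  ⇒-renTm ρ (pδ&₁ d e)        = pδ&₁ (⇒-renTm ρ d) (⇒-renTm (extR ρ) e)
  ⇒-renTm ρ (pδ&₂ d e)        = pδ&₂ (⇒-renTm ρ d) (⇒-renTm (extR ρ) e)
  ⇒-renTm ρ (pinl d)          = pinl (⇒-renTm ρ d)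
  ⇒-renTm ρ (pinr d)          = pinr (⇒-renTm ρ d)
  ⇒-renTm ρ (pδ⊕ d e f)       = pδ⊕ (⇒-renTm ρ d) (⇒-renTm (extR ρ) e) (⇒-renTm (extR ρ) f)
  ⇒-renTm ρ (p! d)            = p! (⇒-renTm ρ d)
  ⇒-renTm ρ (pδ! d e)         = pδ! (⇒-renTm ρ d) (⇒-renTm (extR ρ) e)
  ⇒-renTm ρ (pΛ d)            = pΛ (⇒-renTm ρ d)
  ⇒-renTm ρ (p·ᵀ d)           = p·ᵀ (⇒-renTm ρ d)
  ⇒-renTm ρ (pβ𝟏 d)           = pβ𝟏 (⇒-renTm ρ d)
  ⇒-renTm ρ (pβ⊸ {t' = t'} {u' = u'} d e) =
    subst (_ ⇒_) (sym (renTm-[] ρ t' u')) (pβ⊸ (⇒-renTm (extR ρ) d) (⇒-renTm ρ e))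
  ⇒-renTm ρ (pβ⊗ {u' = u'} {v' = v'} {w' = w'} d e f) =
    subst (_ ⇒_) (sym (renTm-[,] ρ w' u' v')) (pβ⊗ (⇒-renTm ρ d) (⇒-renTm ρ e) (⇒-renTm (extR (extR ρ)) f))
  ⇒-renTm ρ (pβ&₁ {t' = t'} {v' = v'} d e) =
    subst (_ ⇒_) (sym (renTm-[] ρ v' t')) (pβ&₁ (⇒-renTm ρ d) (⇒-renTm (extR ρ) e))
  ⇒-renTm ρ (pβ&₂ {u' = u'} {v' = v'} d e) =
    subst (_ ⇒_) (sym (renTm-[] ρ v' u')) (pβ&₂ (⇒-renTm ρ d) (⇒-renTm (extR ρ) e))
  ⇒-renTm ρ (pβ⊕₁ {t' = t'} {v' = v'} d e) =
    subst (_ ⇒_) (sym (renTm-[] ρ v' t')) (pβ⊕₁ (⇒-renTm ρ d) (⇒-renTm (extR ρ) e))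
  ⇒-renTm ρ (pβ⊕₂ {t' = t'} {w' = w'} d e) =
    subst (_ ⇒_) (sym (renTm-[] ρ w' t')) (pβ⊕₂ (⇒-renTm ρ d) (⇒-renTm (extR ρ) e))
  ⇒-renTm ρ (pβ! {t' = t'} {u' = u'} d e) =
    subst (_ ⇒_) (sym (renTm-[] ρ u' t')) (pβ! (⇒-renTm ρ d) (⇒-renTm (extR ρ) e))
  ⇒-renTm ρ (pβ∀ {t' = t'} d) =
    subst (_ ⇒_) (sym (renTm-subTyTm t')) (pβ∀ (⇒-renTm ρ d))
  ⇒-renTm ρ p⊞𝟏               = p⊞𝟏
  ⇒-renTm ρ (p⊞⊸ d e)         = p⊞⊸ (⇒-renTm (extR ρ) d) (⇒-renTm (extR ρ) e)
  ⇒-renTm ρ (p⊞⊗ d e f)       = p⊞⊗ (⇒-renTm ρ d) (⇒-renTm ρ e) (⇒-renTm (extR (extR ρ)) f)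
  ⇒-renTm ρ p⊞⊤               = p⊞⊤
  ⇒-renTm ρ (p⊞& d e f g)     = p⊞& (⇒-renTm ρ d) (⇒-renTm ρ e) (⇒-renTm ρ f) (⇒-renTm ρ g)
  ⇒-renTm ρ (p⊞⊕ d e f g)     =
    p⊞⊕ (⇒-renTm ρ d) (⇒-renTm ρ e) (⇒-renTm (extR ρ) f) (⇒-renTm (extR ρ) g)
  ⇒-renTm ρ (p⊞! d e)         = p⊞! (⇒-renTm ρ d) (⇒-renTm ρ e)
  ⇒-renTm ρ (p⊞∀ d e)         = p⊞∀ (⇒-renTm ρ d) (⇒-renTm ρ e)
  ⇒-renTm ρ p•𝟏               = p•𝟏
  ⇒-renTm ρ (p•⊸ d)           = p•⊸ (⇒-renTm (extR ρ) d)
  ⇒-renTm ρ (p•⊗ d e)         = p•⊗ (⇒-renTm ρ d) (⇒-renTm (extR (extR ρ)) e)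
  ⇒-renTm ρ p•⊤               = p•⊤
  ⇒-renTm ρ (p•& d e)         = p•& (⇒-renTm ρ d) (⇒-renTm ρ e)
  ⇒-renTm ρ (p•⊕ d e f)       = p•⊕ (⇒-renTm ρ d) (⇒-renTm (extR ρ) e) (⇒-renTm (extR ρ) f)
  ⇒-renTm ρ (p•! d)           = p•! (⇒-renTm ρ d)
  ⇒-renTm ρ (p•∀ d)           = p•∀ (⇒-renTm ρ d)

  ⇒-subTyTm : (σ : Fin n → Ty n') → t ⇒ t' → subTyTm σ t ⇒ subTyTm σ t'
  ⇒-subTyTm σ pvar            = pvar
  ⇒-subTyTm σ (p⊞ d e)        = p⊞ (⇒-subTyTm σ d) (⇒-subTyTm σ e)
  ⇒-subTyTm σ (p• d)          = p• (⇒-subTyTm σ d)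
  ⇒-subTyTm σ p⋆              = p⋆
  ⇒-subTyTm σ (pδ𝟏 d e)       = pδ𝟏 (⇒-subTyTm σ d) (⇒-subTyTm σ e)
  ⇒-subTyTm σ (pƛ d)          = pƛ (⇒-subTyTm σ d)
  ⇒-subTyTm σ (p· d e)        = p· (⇒-subTyTm σ d) (⇒-subTyTm σ e)
  ⇒-subTyTm σ (p⊗ d e)        = p⊗ (⇒-subTyTm σ d) (⇒-subTyTm σ e)
  ⇒-subTyTm σ (pδ⊗ d e)       = pδ⊗ (⇒-subTyTm σ d) (⇒-subTyTm σ e)
  ⇒-subTyTm σ p⟨⟩             = p⟨⟩
  ⇒-subTyTm σ (pδ𝟎 d)         = pδ𝟎 (⇒-subTyTm σ d)
  ⇒-subTyTm σ (p⟨,⟩ d e)      = p⟨,⟩ (⇒-subTyTm σ d) (⇒-subTyTm σ e)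
  ⇒-subTyTm σ (pδ&₁ d e)      = pδ&₁ (⇒-subTyTm σ d) (⇒-subTyTm σ e)
  ⇒-subTyTm σ (pδ&₂ d e)      = pδ&₂ (⇒-subTyTm σ d) (⇒-subTyTm σ e)
  ⇒-subTyTm σ (pinl d)        = pinl (⇒-subTyTm σ d)
  ⇒-subTyTm σ (pinr d)        = pinr (⇒-subTyTm σ d)
  ⇒-subTyTm σ (pδ⊕ d e f)     = pδ⊕ (⇒-subTyTm σ d) (⇒-subTyTm σ e) (⇒-subTyTm σ f)
  ⇒-subTyTm σ (p! d)          = p! (⇒-subTyTm σ d)
  ⇒-subTyTm σ (pδ! d e)       = pδ! (⇒-subTyTm σ d) (⇒-subTyTm σ e)
  ⇒-subTyTm σ (pΛ d)          = pΛ (⇒-subTyTm (extsTy σ) d)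
  ⇒-subTyTm σ (p·ᵀ d)         = p·ᵀ (⇒-subTyTm σ d)
  ⇒-subTyTm σ (pβ𝟏 d)         = pβ𝟏 (⇒-subTyTm σ d)
  ⇒-subTyTm σ (pβ⊸ {t' = t'} {u' = u'} d e) =
    subst (_ ⇒_) (sym (subTyTm-[] σ t' u')) (pβ⊸ (⇒-subTyTm σ d) (⇒-subTyTm σ e))
  ⇒-subTyTm σ (pβ⊗ {u' = u'} {v' = v'} {w' = w'} d e f) =
    subst (_ ⇒_) (sym (subTyTm-[,] σ w' u' v')) (pβ⊗ (⇒-subTyTm σ d) (⇒-subTyTm σ e) (⇒-subTyTm σ f))
  ⇒-subTyTm σ (pβ&₁ {t' = t'} {v' = v'} d e) =
    subst (_ ⇒_) (sym (subTyTm-[] σ v' t')) (pβ&₁ (⇒-subTyTm σ d) (⇒-subTyTm σ e))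
  ⇒-subTyTm σ (pβ&₂ {u' = u'} {v' = v'} d e) =
    subst (_ ⇒_) (sym (subTyTm-[] σ v' u')) (pβ&₂ (⇒-subTyTm σ d) (⇒-subTyTm σ e))
  ⇒-subTyTm σ (pβ⊕₁ {t' = t'} {v' = v'} d e) =
    subst (_ ⇒_) (sym (subTyTm-[] σ v' t')) (pβ⊕₁ (⇒-subTyTm σ d) (⇒-subTyTm σ e))
  ⇒-subTyTm σ (pβ⊕₂ {t' = t'} {w' = w'} d e) =
    subst (_ ⇒_) (sym (subTyTm-[] σ w' t')) (pβ⊕₂ (⇒-subTyTm σ d) (⇒-subTyTm σ e))
  ⇒-subTyTm σ (pβ! {t' = t'} {u' = u'} d e) =
    subst (_ ⇒_) (sym (subTyTm-[] σ u' t')) (pβ! (⇒-subTyTm σ d) (⇒-subTyTm σ e))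
  ⇒-subTyTm σ (pβ∀ {A' = B} {t' = t'} d) =
    subst (_ ⇒_) (sym (subTyTm-[]ᵀ σ t' B)) (pβ∀ (⇒-subTyTm (extsTy σ) d))
  ⇒-subTyTm σ p⊞𝟏             = p⊞𝟏
  ⇒-subTyTm σ (p⊞⊸ d e)       = p⊞⊸ (⇒-subTyTm σ d) (⇒-subTyTm σ e)
  ⇒-subTyTm σ (p⊞⊗ d e f)     = p⊞⊗ (⇒-subTyTm σ d) (⇒-subTyTm σ e) (⇒-subTyTm σ f)
  ⇒-subTyTm σ p⊞⊤             = p⊞⊤
  ⇒-subTyTm σ (p⊞& d e f g)   = p⊞& (⇒-subTyTm σ d) (⇒-subTyTm σ e) (⇒-subTyTm σ f) (⇒-subTyTm σ g)
  ⇒-subTyTm σ (p⊞⊕ d e f g)   = p⊞⊕ (⇒-subTyTm σ d) (⇒-subTyTm σ e) (⇒-subTyTm σ f) (⇒-subTyTm σ g)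
  ⇒-subTyTm σ (p⊞! d e)       = p⊞! (⇒-subTyTm σ d) (⇒-subTyTm σ e)
  ⇒-subTyTm σ (p⊞∀ d e)       = p⊞∀ (⇒-subTyTm (extsTy σ) d) (⇒-subTyTm (extsTy σ) e)
  ⇒-subTyTm σ p•𝟏             = p•𝟏
  ⇒-subTyTm σ (p•⊸ d)         = p•⊸ (⇒-subTyTm σ d)
  ⇒-subTyTm σ (p•⊗ d e)       = p•⊗ (⇒-subTyTm σ d) (⇒-subTyTm σ e)
  ⇒-subTyTm σ p•⊤             = p•⊤
  ⇒-subTyTm σ (p•& d e)       = p•& (⇒-subTyTm σ d) (⇒-subTyTm σ e)
  ⇒-subTyTm σ (p•⊕ d e f)     = p•⊕ (⇒-subTyTm σ d) (⇒-subTyTm σ e) (⇒-subTyTm σ f)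
  ⇒-subTyTm σ (p•! d)         = p•! (⇒-subTyTm σ d)
  ⇒-subTyTm σ (p•∀ d)         = p•∀ (⇒-subTyTm (extsTy σ) d)

  ⇒-extsTm : {σ σ' : Fin m → Tm n m'} → (∀ i → σ i ⇒ σ' i) → ∀ i → extsTm σ i ⇒ extsTm σ' i
  ⇒-extsTm h zero    = pvar
  ⇒-extsTm h (suc i) = ⇒-renTm suc (h i)

  ⇒-subTm : {σ σ' : Fin m → Tm n m'} → (∀ i → σ i ⇒ σ' i) → t ⇒ t' → subTm σ t ⇒ subTm σ' t'
  ⇒-subTm h pvar              = h _
  ⇒-subTm h (p⊞ d e)          = p⊞ (⇒-subTm h d) (⇒-subTm h e)
  ⇒-subTm h (p• d)            = p• (⇒-subTm h d)
  ⇒-subTm h p⋆                = p⋆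
  ⇒-subTm h (pδ𝟏 d e)         = pδ𝟏 (⇒-subTm h d) (⇒-subTm h e)
  ⇒-subTm h (pƛ d)            = pƛ (⇒-subTm (⇒-extsTm h) d)
  ⇒-subTm h (p· d e)          = p· (⇒-subTm h d) (⇒-subTm h e)
  ⇒-subTm h (p⊗ d e)          = p⊗ (⇒-subTm h d) (⇒-subTm h e)
  ⇒-subTm h (pδ⊗ d e)         = pδ⊗ (⇒-subTm h d) (⇒-subTm (⇒-extsTm (⇒-extsTm h)) e)
  ⇒-subTm h p⟨⟩               = p⟨⟩
  ⇒-subTm h (pδ𝟎 d)           = pδ𝟎 (⇒-subTm h d)
  ⇒-subTm h (p⟨,⟩ d e)        = p⟨,⟩ (⇒-subTm h d) (⇒-subTm h e)
  ⇒-subTm h (pδ&₁ d e)        = pδ&₁ (⇒-subTm h d) (⇒-subTm (⇒-extsTm h) e)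
  ⇒-subTm h (pδ&₂ d e)        = pδ&₂ (⇒-subTm h d) (⇒-subTm (⇒-extsTm h) e)
  ⇒-subTm h (pinl d)          = pinl (⇒-subTm h d)
  ⇒-subTm h (pinr d)          = pinr (⇒-subTm h d)
  ⇒-subTm h (pδ⊕ d e f)       = pδ⊕ (⇒-subTm h d) (⇒-subTm (⇒-extsTm h) e) (⇒-subTm (⇒-extsTm h) f)
  ⇒-subTm h (p! d)            = p! (⇒-subTm h d)
  ⇒-subTm h (pδ! d e)         = pδ! (⇒-subTm h d) (⇒-subTm (⇒-extsTm h) e)
  ⇒-subTm h (pΛ d)            = pΛ (⇒-subTm (⇒-subTyTm _ ∘ h) d)
  ⇒-subTm h (p·ᵀ d)           = p·ᵀ (⇒-subTm h d)
  ⇒-subTm h (pβ𝟏 d)           = pβ𝟏 (⇒-subTm h d)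
  ⇒-subTm {σ' = σ'} h (pβ⊸ {t' = t'} {u' = u'} d e) =
    subst (_ ⇒_) (sym (subTm-[] σ' t' u')) (pβ⊸ (⇒-subTm (⇒-extsTm h) d) (⇒-subTm h e))
  ⇒-subTm {σ' = σ'} h (pβ⊗ {u' = u'} {v' = v'} {w' = w'} d e f) =
    subst (_ ⇒_) (sym (subTm-[,] σ' w' u' v'))
          (pβ⊗ (⇒-subTm h d) (⇒-subTm h e) (⇒-subTm (⇒-extsTm (⇒-extsTm h)) f))
  ⇒-subTm {σ' = σ'} h (pβ&₁ {t' = t'} {v' = v'} d e) =
    subst (_ ⇒_) (sym (subTm-[] σ' v' t')) (pβ&₁ (⇒-subTm h d) (⇒-subTm (⇒-extsTm h) e))
  ⇒-subTm {σ' = σ'} h (pβ&₂ {u' = u'} {v' = v'} d e) =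
    subst (_ ⇒_) (sym (subTm-[] σ' v' u')) (pβ&₂ (⇒-subTm h d) (⇒-subTm (⇒-extsTm h) e))
  ⇒-subTm {σ' = σ'} h (pβ⊕₁ {t' = t'} {v' = v'} d e) =
    subst (_ ⇒_) (sym (subTm-[] σ' v' t')) (pβ⊕₁ (⇒-subTm h d) (⇒-subTm (⇒-extsTm h) e))
  ⇒-subTm {σ' = σ'} h (pβ⊕₂ {t' = t'} {w' = w'} d e) =
    subst (_ ⇒_) (sym (subTm-[] σ' w' t')) (pβ⊕₂ (⇒-subTm h d) (⇒-subTm (⇒-extsTm h) e))
  ⇒-subTm {σ' = σ'} h (pβ! {t' = t'} {u' = u'} d e) =
    subst (_ ⇒_) (sym (subTm-[] σ' u' t')) (pβ! (⇒-subTm h d) (⇒-subTm (⇒-extsTm h) e))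
  ⇒-subTm {σ' = σ'} h (pβ∀ {A' = B} {t' = t'} d) =
    subst (_ ⇒_) (sym (subTm-[]ᵀ σ' t' B)) (pβ∀ (⇒-subTm (⇒-subTyTm _ ∘ h) d))
  ⇒-subTm h p⊞𝟏               = p⊞𝟏
  ⇒-subTm h (p⊞⊸ d e)         = p⊞⊸ (⇒-subTm (⇒-extsTm h) d) (⇒-subTm (⇒-extsTm h) e)
  ⇒-subTm h (p⊞⊗ d e f)       = p⊞⊗ (⇒-subTm h d) (⇒-subTm h e) (⇒-subTm (⇒-extsTm (⇒-extsTm h)) f)
  ⇒-subTm h p⊞⊤               = p⊞⊤
  ⇒-subTm h (p⊞& d e f g)     = p⊞& (⇒-subTm h d) (⇒-subTm h e) (⇒-subTm h f) (⇒-subTm h g)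
  ⇒-subTm h (p⊞⊕ d e f g)     =
    p⊞⊕ (⇒-subTm h d) (⇒-subTm h e) (⇒-subTm (⇒-extsTm h) f) (⇒-subTm (⇒-extsTm h) g)
  ⇒-subTm h (p⊞! d e)         = p⊞! (⇒-subTm h d) (⇒-subTm h e)
  ⇒-subTm h (p⊞∀ d e)         = p⊞∀ (⇒-subTm (⇒-subTyTm _ ∘ h) d) (⇒-subTm (⇒-subTyTm _ ∘ h) e)
  ⇒-subTm h p•𝟏               = p•𝟏
  ⇒-subTm h (p•⊸ d)           = p•⊸ (⇒-subTm (⇒-extsTm h) d)
  ⇒-subTm h (p•⊗ d e)         = p•⊗ (⇒-subTm h d) (⇒-subTm (⇒-extsTm (⇒-extsTm h)) e)
  ⇒-subTm h p•⊤               = p•⊤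
  ⇒-subTm h (p•& d e)         = p•& (⇒-subTm h d) (⇒-subTm h e)
  ⇒-subTm h (p•⊕ d e f)       = p•⊕ (⇒-subTm h d) (⇒-subTm (⇒-extsTm h) e) (⇒-subTm (⇒-extsTm h) f)
  ⇒-subTm h (p•! d)           = p•! (⇒-subTm h d)
  ⇒-subTm h (p•∀ d)           = p•∀ (⇒-subTm (⇒-subTyTm _ ∘ h) d)

  ⇒-[] : {t t' : Tm n (suc m)} → t ⇒ t' → u ⇒ u' → t [ u ] ⇒ t' [ u' ]
  ⇒-[] d e = ⇒-subTm ⇒-ς₁ d
    where
    ⇒-ς₁ : ∀ i → ς₁ _ i ⇒ ς₁ _ i
    ⇒-ς₁ zero    = e
    ⇒-ς₁ (suc i) = pvar

  ⇒-[,] : {w w' : Tm n (suc (suc m))} → w ⇒ w' → u ⇒ u' → v ⇒ v' → w [ u , v ] ⇒ w' [ u' , v' ]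
  ⇒-[,] d e f = ⇒-subTm ⇒-ς₂ d
    where
    ⇒-ς₂ : ∀ i → ς₂ _ _ i ⇒ ς₂ _ _ i
    ⇒-ς₂ zero          = f
    ⇒-ς₂ (suc zero)    = e
    ⇒-ς₂ (suc (suc i)) = pvar

  -- Subject reduction and the triangle property

  subject-reduction : {t u : Tm n m} {A : Ty n} → Γ ⊢ t ∶ A → t ⇒ u → Γ ⊢ u ∶ A
  subject-reduction ⊢t pvar                                 = ⊢t
  subject-reduction (⊢⊞ ⊢t ⊢u) (p⊞ d e) =
    ⊢⊞ (subject-reduction ⊢t d) (subject-reduction ⊢u e)
  subject-reduction (⊢• ⊢t) (p• d)                          = ⊢• (subject-reduction ⊢t d)
  subject-reduction ⊢t p⋆                                   = ⊢t
  subject-reduction (⊢δ𝟏 ⊢t ⊢u) (pδ𝟏 d e) =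
    ⊢δ𝟏 (subject-reduction ⊢t d) (subject-reduction ⊢u e)
  subject-reduction (⊢ƛ ⊢t) (pƛ d)                          = ⊢ƛ (subject-reduction ⊢t d)
  subject-reduction (⊢· ⊢t ⊢u) (p· d e) =
    ⊢· (subject-reduction ⊢t d) (subject-reduction ⊢u e)
  subject-reduction (⊢⊗ ⊢t ⊢u) (p⊗ d e) =
    ⊢⊗ (subject-reduction ⊢t d) (subject-reduction ⊢u e)
  subject-reduction (⊢δ⊗ ⊢t ⊢u) (pδ⊗ d e) =
    ⊢δ⊗ (subject-reduction ⊢t d) (subject-reduction ⊢u e)
  subject-reduction ⊢t p⟨⟩                                  = ⊢t
  subject-reduction (⊢δ𝟎 ⊢t) (pδ𝟎 d)                        = ⊢δ𝟎 (subject-reduction ⊢t d)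
  subject-reduction (⊢⟨,⟩ ⊢t ⊢u) (p⟨,⟩ d e) =
    ⊢⟨,⟩ (subject-reduction ⊢t d) (subject-reduction ⊢u e)
  subject-reduction (⊢δ&₁ ⊢t ⊢u) (pδ&₁ d e) =
    ⊢δ&₁ (subject-reduction ⊢t d) (subject-reduction ⊢u e)
  subject-reduction (⊢δ&₂ ⊢t ⊢u) (pδ&₂ d e) =
    ⊢δ&₂ (subject-reduction ⊢t d) (subject-reduction ⊢u e)
  subject-reduction (⊢inl ⊢t) (pinl d)                      = ⊢inl (subject-reduction ⊢t d)
  subject-reduction (⊢inr ⊢t) (pinr d)                      = ⊢inr (subject-reduction ⊢t d)
  subject-reduction (⊢δ⊕ ⊢t ⊢v ⊢w) (pδ⊕ d e f)              =
    ⊢δ⊕ (subject-reduction ⊢t d) (subject-reduction ⊢v e) (subject-reduction ⊢w f)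
  subject-reduction (⊢! ⊢t) (p! d)                          = ⊢! (subject-reduction ⊢t d)
  subject-reduction (⊢δ! ⊢t ⊢u) (pδ! d e) =
    ⊢δ! (subject-reduction ⊢t d) (subject-reduction ⊢u e)
  subject-reduction (⊢Λ ⊢t) (pΛ d)                          = ⊢Λ (subject-reduction ⊢t d)
  subject-reduction (⊢·ᵀ ⊢t) (p·ᵀ d)                        = ⊢·ᵀ (subject-reduction ⊢t d)
  subject-reduction (⊢δ𝟏 _ ⊢u) (pβ𝟏 e)                      = ⊢• (subject-reduction ⊢u e)
  subject-reduction (⊢· (⊢ƛ ⊢t) ⊢u) (pβ⊸ d e) =
    ⊢[] (subject-reduction ⊢t d) (subject-reduction ⊢u e)
  subject-reduction (⊢δ⊗ (⊢⊗ ⊢u ⊢v) ⊢w) (pβ⊗ d e f)         =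
    ⊢[,] (subject-reduction ⊢w f) (subject-reduction ⊢u d) (subject-reduction ⊢v e)
  subject-reduction (⊢δ&₁ (⊢⟨,⟩ ⊢t _) ⊢v) (pβ&₁ d e) =
    ⊢[] (subject-reduction ⊢v e) (subject-reduction ⊢t d)
  subject-reduction (⊢δ&₂ (⊢⟨,⟩ _ ⊢u) ⊢v) (pβ&₂ d e) =
    ⊢[] (subject-reduction ⊢v e) (subject-reduction ⊢u d)
  subject-reduction (⊢δ⊕ (⊢inl ⊢t) ⊢v _) (pβ⊕₁ d e) =
    ⊢[] (subject-reduction ⊢v e) (subject-reduction ⊢t d)
  subject-reduction (⊢δ⊕ (⊢inr ⊢t) _ ⊢w) (pβ⊕₂ d e) =
    ⊢[] (subject-reduction ⊢w e) (subject-reduction ⊢t d)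
  subject-reduction (⊢δ! (⊢! ⊢t) ⊢u) (pβ! d e) =
    ⊢[] (subject-reduction ⊢u e) (subject-reduction ⊢t d)
  subject-reduction (⊢·ᵀ (⊢Λ ⊢t)) (pβ∀ d)                   = ⊢[]ᵀ _ (subject-reduction ⊢t d)
  subject-reduction (⊢⊞ ⊢⋆ _) p⊞𝟏                           = ⊢⋆
  subject-reduction (⊢⊞ (⊢ƛ ⊢t) (⊢ƛ ⊢u)) (p⊞⊸ d e) =
    ⊢ƛ (⊢⊞ (subject-reduction ⊢t d) (subject-reduction ⊢u e))
  subject-reduction (⊢δ⊗ (⊢⊞ ⊢t ⊢u) ⊢v) (p⊞⊗ d e f)         =
    ⊢⊞ (⊢δ⊗ (subject-reduction ⊢t d) (subject-reduction ⊢v f))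
       (⊢δ⊗ (subject-reduction ⊢u e) (subject-reduction ⊢v f))
  subject-reduction (⊢⊞ ⊢⟨⟩ _) p⊞⊤                          = ⊢⟨⟩
  subject-reduction (⊢⊞ (⊢⟨,⟩ ⊢t ⊢u) (⊢⟨,⟩ ⊢v ⊢w)) (p⊞& d e f g) =
    ⊢⟨,⟩ (⊢⊞ (subject-reduction ⊢t d) (subject-reduction ⊢v f))
         (⊢⊞ (subject-reduction ⊢u e) (subject-reduction ⊢w g))
  subject-reduction (⊢δ⊕ (⊢⊞ ⊢t ⊢u) ⊢v ⊢w) (p⊞⊕ d e f g)    =
    ⊢⊞ (⊢δ⊕ (subject-reduction ⊢t d) (subject-reduction ⊢v f) (subject-reduction ⊢w g))
       (⊢δ⊕ (subject-reduction ⊢u e) (subject-reduction ⊢v f) (subject-reduction ⊢w g))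
  subject-reduction (⊢⊞ (⊢! ⊢t) (⊢! ⊢u)) (p⊞! d e) =
    ⊢! (⊢⊞ (subject-reduction ⊢t d) (subject-reduction ⊢u e))
  subject-reduction (⊢⊞ (⊢Λ ⊢t) (⊢Λ ⊢u)) (p⊞∀ d e) =
    ⊢Λ (⊢⊞ (subject-reduction ⊢t d) (subject-reduction ⊢u e))
  subject-reduction (⊢• ⊢⋆) p•𝟏                             = ⊢⋆
  subject-reduction (⊢• (⊢ƛ ⊢t)) (p•⊸ d)                    = ⊢ƛ (⊢• (subject-reduction ⊢t d))
  subject-reduction (⊢δ⊗ (⊢• ⊢t) ⊢v) (p•⊗ d e) =
    ⊢• (⊢δ⊗ (subject-reduction ⊢t d) (subject-reduction ⊢v e))
  subject-reduction (⊢• ⊢⟨⟩) p•⊤                            = ⊢⟨⟩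
  subject-reduction (⊢• (⊢⟨,⟩ ⊢t ⊢u)) (p•& d e) =
    ⊢⟨,⟩ (⊢• (subject-reduction ⊢t d)) (⊢• (subject-reduction ⊢u e))
  subject-reduction (⊢δ⊕ (⊢• ⊢t) ⊢v ⊢w) (p•⊕ d e f)         =
    ⊢• (⊢δ⊕ (subject-reduction ⊢t d) (subject-reduction ⊢v e) (subject-reduction ⊢w f))
  subject-reduction (⊢• (⊢! ⊢t)) (p•! d)                    = ⊢! (⊢• (subject-reduction ⊢t d))
  subject-reduction (⊢• (⊢Λ ⊢t)) (p•∀ d)                    = ⊢Λ (⊢• (subject-reduction ⊢t d))

  data ⊞-View : Tm n m → Tm n m → Set ℓ₁ where
    ⋆⊞⋆       : (x y : Carrier) → ⊞-View {n} {m} (x ∙⋆) (y ∙⋆)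
    ƛ⊞ƛ       : (A : Ty n) (t : Tm n (suc m)) (B : Ty n) (u : Tm n (suc m)) → ⊞-View (ƛ A t) (ƛ B u)
    ⟨⟩⊞⟨⟩     : ⊞-View {n} {m} ⟨⟩ ⟨⟩
    ⟨,⟩⊞⟨,⟩   : (t u v w : Tm n m) → ⊞-View ⟨ t , u ⟩ ⟨ v , w ⟩
    !⊞!       : (t u : Tm n m) → ⊞-View (! t) (! u)
    Λ⊞Λ       : (t u : Tm (suc n) m) → ⊞-View (Λ t) (Λ u)
    other     : ⊞-View t u

  ⊞-view : (t u : Tm n m) → ⊞-View t u
  ⊞-view (x ∙⋆) (y ∙⋆)           = ⋆⊞⋆ x y
  ⊞-view (ƛ A t) (ƛ B u)         = ƛ⊞ƛ A t B u
  ⊞-view ⟨⟩ ⟨⟩                   = ⟨⟩⊞⟨⟩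
  ⊞-view ⟨ t , u ⟩ ⟨ v , w ⟩     = ⟨,⟩⊞⟨,⟩ t u v w
  ⊞-view (! t) (! u)             = !⊞! t u
  ⊞-view (Λ t) (Λ u)             = Λ⊞Λ t u
  ⊞-view _ _                     = other

  data •-View : Tm n m → Set ℓ₁ where
    is⋆   : (x : Carrier) → •-View {n} {m} (x ∙⋆)
    isƛ   : (A : Ty n) (t : Tm n (suc m)) → •-View (ƛ A t)
    is⟨⟩  : •-View {n} {m} ⟨⟩
    is⟨,⟩ : (t u : Tm n m) → •-View ⟨ t , u ⟩
    is!   : (t : Tm n m) → •-View (! t)
    isΛ   : (t : Tm (suc n) m) → •-View (Λ t)
    other : •-View t

  •-view : (t : Tm n m) → •-View t
  •-view (x ∙⋆)    = is⋆ x
  •-view (ƛ A t)   = isƛ A t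
  •-view ⟨⟩        = is⟨⟩
  •-view ⟨ t , u ⟩ = is⟨,⟩ t u
  •-view (! t)     = is! t
  •-view (Λ t)     = isΛ t
  •-view _         = other

  data δ𝟏-View : Tm n m → Set ℓ₁ where
    is⋆   : (x : Carrier) → δ𝟏-View {n} {m} (x ∙⋆)
    other : δ𝟏-View t

  δ𝟏-view : (t : Tm n m) → δ𝟏-View t
  δ𝟏-view (x ∙⋆) = is⋆ x
  δ𝟏-view _      = other

  data ·-View : Tm n m → Set ℓ₁ where
    isƛ   : (A : Ty n) (t : Tm n (suc m)) → ·-View (ƛ A t)
    other : ·-View t

  ·-view : (t : Tm n m) → ·-View t
  ·-view (ƛ A t) = isƛ A t
  ·-view _       = other

  data δ⊗-View : Tm n m → Set ℓ₁ where
    is⊗   : (u v : Tm n m) → δ⊗-View (u ⊗ₜ v)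
    is⊞   : (t u : Tm n m) → δ⊗-View (t ⊞ u)
    is•   : (x : Carrier) (t : Tm n m) → δ⊗-View (x • t)
    other : δ⊗-View t

  δ⊗-view : (t : Tm n m) → δ⊗-View t
  δ⊗-view (u ⊗ₜ v) = is⊗ u v
  δ⊗-view (t ⊞ u)  = is⊞ t u
  δ⊗-view (x • t)  = is• x t
  δ⊗-view _        = other

  data δ&-View : Tm n m → Set ℓ₁ where
    is⟨,⟩ : (t u : Tm n m) → δ&-View ⟨ t , u ⟩
    other : δ&-View t

  δ&-view : (t : Tm n m) → δ&-View t
  δ&-view ⟨ t , u ⟩ = is⟨,⟩ t u
  δ&-view _         = other

  data δ⊕-View : Tm n m → Set ℓ₁ where
    isinl : (t : Tm n m) → δ⊕-View (inl t)
    isinr : (t : Tm n m) → δ⊕-View (inr t)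
    is⊞   : (t u : Tm n m) → δ⊕-View (t ⊞ u)
    is•   : (x : Carrier) (t : Tm n m) → δ⊕-View (x • t)
    other : δ⊕-View t

  δ⊕-view : (t : Tm n m) → δ⊕-View t
  δ⊕-view (inl t) = isinl t
  δ⊕-view (inr t) = isinr t
  δ⊕-view (t ⊞ u) = is⊞ t u
  δ⊕-view (x • t) = is• x t
  δ⊕-view _       = other

  data δ!-View : Tm n m → Set ℓ₁ where
    is!   : (t : Tm n m) → δ!-View (! t)
    other : δ!-View t

  δ!-view : (t : Tm n m) → δ!-View t
  δ!-view (! t) = is! t
  δ!-view _     = other

  data ·ᵀ-View : Tm n m → Set ℓ₁ where
    isΛ   : (t : Tm (suc n) m) → ·ᵀ-View (Λ t)
    other : ·ᵀ-View t

  ·ᵀ-view : (t : Tm n m) → ·ᵀ-View t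
  ·ᵀ-view (Λ t) = isΛ t
  ·ᵀ-view _     = other

  develop : Tm n m → Tm n m
  develop (var i) = var i
  develop (t ⊞ u) with ⊞-view t u
  ... | ⋆⊞⋆ x y             = (x +ₛ y) ∙⋆
  -- on well-typed terms A ≡ B here, so this is an instance of ⊞⊸
  ... | ƛ⊞ƛ A t₀ _ u₀       = ƛ A (develop t₀ ⊞ develop u₀)
  ... | ⟨⟩⊞⟨⟩               = ⟨⟩
  ... | ⟨,⟩⊞⟨,⟩ t₁ t₂ u₁ u₂ = ⟨ develop t₁ ⊞ develop u₁ , develop t₂ ⊞ develop u₂ ⟩
  ... | !⊞! t₀ u₀           = ! (develop t₀ ⊞ develop u₀)
  ... | Λ⊞Λ t₀ u₀           = Λ (develop t₀ ⊞ develop u₀)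
  ... | other               = develop t ⊞ develop u
  develop (x • t) with •-view t
  ... | is⋆ y         = (x *ₛ y) ∙⋆
  ... | isƛ A t₀      = ƛ A (x • develop t₀)
  ... | is⟨⟩          = ⟨⟩
  ... | is⟨,⟩ t₁ t₂   = ⟨ x • develop t₁ , x • develop t₂ ⟩
  ... | is! t₀        = ! (x • develop t₀)
  ... | isΛ t₀        = Λ (x • develop t₀)
  ... | other         = x • develop t
  develop (x ∙⋆) = x ∙⋆
  develop (δ𝟏 t u) with δ𝟏-view t
  ... | is⋆ x = x • develop u
  ... | other = δ𝟏 (develop t) (develop u)
  develop (ƛ A t) = ƛ A (develop t)
  develop (t · u) with ·-view t
  ... | isƛ _ t₀ = develop t₀ [ develop u ]
  ... | other    = develop t · develop u
  develop (t ⊗ₜ u) = develop t ⊗ₜ develop u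
  develop (δ⊗ t A B w) with δ⊗-view t
  ... | is⊗ u v   = develop w [ develop u , develop v ]
  ... | is⊞ t₁ t₂ = δ⊗ (develop t₁) A B (develop w) ⊞ δ⊗ (develop t₂) A B (develop w)
  ... | is• x t₀  = x • δ⊗ (develop t₀) A B (develop w)
  ... | other     = δ⊗ (develop t) A B (develop w)
  develop ⟨⟩ = ⟨⟩
  develop (δ𝟎 t) = δ𝟎 (develop t)
  develop ⟨ t , u ⟩ = ⟨ develop t , develop u ⟩
  develop (δ&₁ t A v) with δ&-view t
  ... | is⟨,⟩ t₁ _ = develop v [ develop t₁ ]
  ... | other      = δ&₁ (develop t) A (develop v)
  develop (δ&₂ t A v) with δ&-view t
  ... | is⟨,⟩ _ t₂ = develop v [ develop t₂ ]
  ... | other      = δ&₂ (develop t) A (develop v)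
  develop (inl t) = inl (develop t)
  develop (inr t) = inr (develop t)
  develop (δ⊕ t A v B w) with δ⊕-view t
  ... | isinl t₀  = develop v [ develop t₀ ]
  ... | isinr t₀  = develop w [ develop t₀ ]
  ... | is⊞ t₁ t₂ =
    δ⊕ (develop t₁) A (develop v) B (develop w) ⊞ δ⊕ (develop t₂) A (develop v) B (develop w)
  ... | is• x t₀  = x • δ⊕ (develop t₀) A (develop v) B (develop w)
  ... | other     = δ⊕ (develop t) A (develop v) B (develop w)
  develop (! t) = ! (develop t)
  develop (δ! t A u) with δ!-view t
  ... | is! t₀ = develop u [ develop t₀ ]
  ... | other  = δ! (develop t) A (develop u)
  develop (Λ t) = Λ (develop t)
  develop (t ·ᵀ A) with ·ᵀ-view t
  ... | isΛ t₀ = develop t₀ [ A ]ᵀ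
  ... | other  = develop t ·ᵀ A

  data Inert : Ty n → Set where
    ⊗-inert : {A B : Ty n} → Inert (A ⊗ B)
    ⊕-inert : {A B : Ty n} → Inert (A ⊕ B)

  data ⊞-Reduct (t u : Tm n m) : Tm n m → Set ℓ₁ where
    ⊞-reduct : t ⇒ t' → u ⇒ u' → ⊞-Reduct t u (t' ⊞ u')

  data •-Reduct (x : Carrier) (t : Tm n m) : Tm n m → Set ℓ₁ where
    •-reduct : t ⇒ t' → •-Reduct x t (x • t')

  ⊞-reduct-inert : {C : Ty n} {s : Tm n m} → Inert C → Γ ⊢ t ⊞ u ∶ C → t ⊞ u ⇒ s → ⊞-Reduct t u s
  ⊞-reduct-inert _ _ (p⊞ d e)                      = ⊞-reduct d e
  ⊞-reduct-inert () (⊢⊞ ⊢⋆ _) p⊞𝟏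
  ⊞-reduct-inert () (⊢⊞ (⊢ƛ _) _) (p⊞⊸ _ _)
  ⊞-reduct-inert () (⊢⊞ ⊢⟨⟩ _) p⊞⊤
  ⊞-reduct-inert () (⊢⊞ (⊢⟨,⟩ _ _) _) (p⊞& _ _ _ _)
  ⊞-reduct-inert () (⊢⊞ (⊢! _) _) (p⊞! _ _)
  ⊞-reduct-inert () (⊢⊞ (⊢Λ _) _) (p⊞∀ _ _)

  •-reduct-inert : {C : Ty n} {s : Tm n m} → Inert C → Γ ⊢ x • t ∶ C → x • t ⇒ s → •-Reduct x t s
  •-reduct-inert _ _ (p• d)                   = •-reduct d
  •-reduct-inert () (⊢• ⊢⋆) p•𝟏
  •-reduct-inert () (⊢• (⊢ƛ _)) (p•⊸ _)
  •-reduct-inert () (⊢• ⊢⟨⟩) p•⊤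
  •-reduct-inert () (⊢• (⊢⟨,⟩ _ _)) (p•& _ _)
  •-reduct-inert () (⊢• (⊢! _)) (p•! _)
  •-reduct-inert () (⊢• (⊢Λ _)) (p•∀ _)

  triangle : {t u : Tm n m} {A : Ty n} → Γ ⊢ t ∶ A → t ⇒ u → u ⇒ develop t
  triangle _ pvar = pvar
  triangle (⊢⊞ ⊢t ⊢u) (p⊞ {t = t} {u = u} d e) with ⊞-view t u
  triangle _ (p⊞ p⋆ p⋆) | ⋆⊞⋆ _ _ = p⊞𝟏
  triangle (⊢⊞ (⊢ƛ ⊢t) (⊢ƛ ⊢u)) (p⊞ (pƛ d) (pƛ e)) | ƛ⊞ƛ _ _ _ _ =
    p⊞⊸ (triangle ⊢t d) (triangle ⊢u e)
  triangle _ (p⊞ p⟨⟩ p⟨⟩) | ⟨⟩⊞⟨⟩ = p⊞⊤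
  triangle (⊢⊞ (⊢⟨,⟩ ⊢t₁ ⊢t₂) (⊢⟨,⟩ ⊢u₁ ⊢u₂)) (p⊞ (p⟨,⟩ d₁ d₂) (p⟨,⟩ e₁ e₂)) | ⟨,⟩⊞⟨,⟩ _ _ _ _ =
    p⊞& (triangle ⊢t₁ d₁) (triangle ⊢t₂ d₂) (triangle ⊢u₁ e₁) (triangle ⊢u₂ e₂)
  triangle (⊢⊞ (⊢! ⊢t) (⊢! ⊢u)) (p⊞ (p! d) (p! e)) | !⊞! _ _ = p⊞! (triangle ⊢t d) (triangle ⊢u e)
  triangle (⊢⊞ (⊢Λ ⊢t) (⊢Λ ⊢u)) (p⊞ (pΛ d) (pΛ e)) | Λ⊞Λ _ _ = p⊞∀ (triangle ⊢t d) (triangle ⊢u e)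
  ... | other = p⊞ (triangle ⊢t d) (triangle ⊢u e)
  triangle (⊢• ⊢t) (p• {t = t} d) with •-view t
  triangle _ (p• p⋆) | is⋆ _ = p•𝟏
  triangle (⊢• (⊢ƛ ⊢t)) (p• (pƛ d)) | isƛ _ _ = p•⊸ (triangle ⊢t d)
  triangle _ (p• p⟨⟩) | is⟨⟩ = p•⊤
  triangle (⊢• (⊢⟨,⟩ ⊢t ⊢u)) (p• (p⟨,⟩ d e)) | is⟨,⟩ _ _ = p•& (triangle ⊢t d) (triangle ⊢u e)
  triangle (⊢• (⊢! ⊢t)) (p• (p! d)) | is! _ = p•! (triangle ⊢t d)
  triangle (⊢• (⊢Λ ⊢t)) (p• (pΛ d)) | isΛ _ = p•∀ (triangle ⊢t d)
  ... | other = p• (triangle ⊢t d)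
  triangle _ p⋆ = p⋆
  triangle (⊢δ𝟏 ⊢t ⊢u) (pδ𝟏 {t = t} d e) with δ𝟏-view t
  triangle (⊢δ𝟏 _ ⊢u) (pδ𝟏 p⋆ e) | is⋆ _ = pβ𝟏 (triangle ⊢u e)
  ... | other = pδ𝟏 (triangle ⊢t d) (triangle ⊢u e)
  triangle (⊢ƛ ⊢t) (pƛ d) = pƛ (triangle ⊢t d)
  triangle (⊢· ⊢t ⊢u) (p· {t = t} d e) with ·-view t
  triangle (⊢· (⊢ƛ ⊢t) ⊢u) (p· (pƛ d) e) | isƛ _ _ = pβ⊸ (triangle ⊢t d) (triangle ⊢u e)
  ... | other = p· (triangle ⊢t d) (triangle ⊢u e)
  triangle (⊢⊗ ⊢t ⊢u) (p⊗ d e) = p⊗ (triangle ⊢t d) (triangle ⊢u e)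
  triangle (⊢δ⊗ ⊢t ⊢w) (pδ⊗ {t = t} d e) with δ⊗-view t
  triangle (⊢δ⊗ (⊢⊗ ⊢u ⊢v) ⊢w) (pδ⊗ (p⊗ d₁ d₂) e) | is⊗ _ _ =
    pβ⊗ (triangle ⊢u d₁) (triangle ⊢v d₂) (triangle ⊢w e)
  triangle (⊢δ⊗ ⊢t ⊢w) (pδ⊗ d e) | is⊞ _ _ with ⊞-reduct-inert ⊗-inert ⊢t d
  triangle (⊢δ⊗ (⊢⊞ ⊢t₁ ⊢t₂) ⊢w) (pδ⊗ _ e) | is⊞ _ _ | ⊞-reduct d₁ d₂ =
    p⊞⊗ (triangle ⊢t₁ d₁) (triangle ⊢t₂ d₂) (triangle ⊢w e)
  triangle (⊢δ⊗ ⊢t ⊢w) (pδ⊗ d e) | is• _ _ with •-reduct-inert ⊗-inert ⊢t d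
  triangle (⊢δ⊗ (⊢• ⊢t₀) ⊢w) (pδ⊗ _ e) | is• _ _ | •-reduct d₀ = p•⊗ (triangle ⊢t₀ d₀) (triangle ⊢w e)
  triangle (⊢δ⊗ ⊢t ⊢w) (pδ⊗ d e) | other = pδ⊗ (triangle ⊢t d) (triangle ⊢w e)
  triangle _ p⟨⟩ = p⟨⟩
  triangle (⊢δ𝟎 ⊢t) (pδ𝟎 d) = pδ𝟎 (triangle ⊢t d)
  triangle (⊢⟨,⟩ ⊢t ⊢u) (p⟨,⟩ d e) = p⟨,⟩ (triangle ⊢t d) (triangle ⊢u e)
  triangle (⊢δ&₁ ⊢t ⊢v) (pδ&₁ {t = t} d e) with δ&-view t
  triangle (⊢δ&₁ (⊢⟨,⟩ ⊢t₁ _) ⊢v) (pδ&₁ (p⟨,⟩ d₁ _) e) | is⟨,⟩ _ _ = pβ&₁ (triangle ⊢t₁ d₁) (triangle ⊢v e)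
  ... | other = pδ&₁ (triangle ⊢t d) (triangle ⊢v e)
  triangle (⊢δ&₂ ⊢t ⊢v) (pδ&₂ {t = t} d e) with δ&-view t
  triangle (⊢δ&₂ (⊢⟨,⟩ _ ⊢t₂) ⊢v) (pδ&₂ (p⟨,⟩ _ d₂) e) | is⟨,⟩ _ _ = pβ&₂ (triangle ⊢t₂ d₂) (triangle ⊢v e)
  ... | other = pδ&₂ (triangle ⊢t d) (triangle ⊢v e)
  triangle (⊢inl ⊢t) (pinl d) = pinl (triangle ⊢t d)
  triangle (⊢inr ⊢t) (pinr d) = pinr (triangle ⊢t d)
  triangle (⊢δ⊕ ⊢t ⊢v ⊢w) (pδ⊕ {t = t} d e f) with δ⊕-view t
  triangle (⊢δ⊕ (⊢inl ⊢t₀) ⊢v _) (pδ⊕ (pinl d₀) e _) | isinl _ = pβ⊕₁ (triangle ⊢t₀ d₀) (triangle ⊢v e)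
  triangle (⊢δ⊕ (⊢inr ⊢t₀) _ ⊢w) (pδ⊕ (pinr d₀) _ f) | isinr _ = pβ⊕₂ (triangle ⊢t₀ d₀) (triangle ⊢w f)
  triangle (⊢δ⊕ ⊢t ⊢v ⊢w) (pδ⊕ d e f) | is⊞ _ _ with ⊞-reduct-inert ⊕-inert ⊢t d
  triangle (⊢δ⊕ (⊢⊞ ⊢t₁ ⊢t₂) ⊢v ⊢w) (pδ⊕ _ e f) | is⊞ _ _ | ⊞-reduct d₁ d₂ =
    p⊞⊕ (triangle ⊢t₁ d₁) (triangle ⊢t₂ d₂) (triangle ⊢v e) (triangle ⊢w f)
  triangle (⊢δ⊕ ⊢t ⊢v ⊢w) (pδ⊕ d e f) | is• _ _ with •-reduct-inert ⊕-inert ⊢t d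
  triangle (⊢δ⊕ (⊢• ⊢t₀) ⊢v ⊢w) (pδ⊕ _ e f) | is• _ _ | •-reduct d₀ =
    p•⊕ (triangle ⊢t₀ d₀) (triangle ⊢v e) (triangle ⊢w f)
  triangle (⊢δ⊕ ⊢t ⊢v ⊢w) (pδ⊕ d e f) | other = pδ⊕ (triangle ⊢t d) (triangle ⊢v e) (triangle ⊢w f)
  triangle (⊢! ⊢t) (p! d) = p! (triangle ⊢t d)
  triangle (⊢δ! ⊢t ⊢u) (pδ! {t = t} d e) with δ!-view t
  triangle (⊢δ! (⊢! ⊢t₀) ⊢u) (pδ! (p! d₀) e) | is! _ = pβ! (triangle ⊢t₀ d₀) (triangle ⊢u e)
  ... | other = pδ! (triangle ⊢t d) (triangle ⊢u e)
  triangle (⊢Λ ⊢t) (pΛ d) = pΛ (triangle ⊢t d)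
  triangle (⊢·ᵀ ⊢t) (p·ᵀ {t = t} d) with ·ᵀ-view t
  triangle (⊢·ᵀ (⊢Λ ⊢t₀)) (p·ᵀ (pΛ d₀)) | isΛ _ = pβ∀ (triangle ⊢t₀ d₀)
  ... | other = p·ᵀ (triangle ⊢t d)
  triangle (⊢δ𝟏 _ ⊢u) (pβ𝟏 e) = p• (triangle ⊢u e)
  triangle (⊢· (⊢ƛ ⊢t) ⊢u) (pβ⊸ d e) = ⇒-[] (triangle ⊢t d) (triangle ⊢u e)
  triangle (⊢δ⊗ (⊢⊗ ⊢u ⊢v) ⊢w) (pβ⊗ d e f) = ⇒-[,] (triangle ⊢w f) (triangle ⊢u d) (triangle ⊢v e)
  triangle (⊢δ&₁ (⊢⟨,⟩ ⊢t _) ⊢v) (pβ&₁ d e) = ⇒-[] (triangle ⊢v e) (triangle ⊢t d)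
  triangle (⊢δ&₂ (⊢⟨,⟩ _ ⊢u) ⊢v) (pβ&₂ d e) = ⇒-[] (triangle ⊢v e) (triangle ⊢u d)
  triangle (⊢δ⊕ (⊢inl ⊢t) ⊢v _) (pβ⊕₁ d e) = ⇒-[] (triangle ⊢v e) (triangle ⊢t d)
  triangle (⊢δ⊕ (⊢inr ⊢t) _ ⊢w) (pβ⊕₂ d e) = ⇒-[] (triangle ⊢w e) (triangle ⊢t d)
  triangle (⊢δ! (⊢! ⊢t) ⊢u) (pβ! d e) = ⇒-[] (triangle ⊢u e) (triangle ⊢t d)
  triangle (⊢·ᵀ (⊢Λ ⊢t)) (pβ∀ d) = ⇒-subTyTm _ (triangle ⊢t d)
  triangle _ p⊞𝟏 = p⋆
  triangle (⊢⊞ (⊢ƛ ⊢t) (⊢ƛ ⊢u)) (p⊞⊸ d e) = pƛ (p⊞ (triangle ⊢t d) (triangle ⊢u e))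
  triangle (⊢δ⊗ (⊢⊞ ⊢t ⊢u) ⊢v) (p⊞⊗ d e f) =
    p⊞ (pδ⊗ (triangle ⊢t d) (triangle ⊢v f)) (pδ⊗ (triangle ⊢u e) (triangle ⊢v f))
  triangle _ p⊞⊤ = p⟨⟩
  triangle (⊢⊞ (⊢⟨,⟩ ⊢t ⊢u) (⊢⟨,⟩ ⊢v ⊢w)) (p⊞& d e f g) =
    p⟨,⟩ (p⊞ (triangle ⊢t d) (triangle ⊢v f)) (p⊞ (triangle ⊢u e) (triangle ⊢w g))
  triangle (⊢δ⊕ (⊢⊞ ⊢t ⊢u) ⊢v ⊢w) (p⊞⊕ d e f g) =
    p⊞ (pδ⊕ (triangle ⊢t d) (triangle ⊢v f) (triangle ⊢w g))
       (pδ⊕ (triangle ⊢u e) (triangle ⊢v f) (triangle ⊢w g))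
  triangle (⊢⊞ (⊢! ⊢t) (⊢! ⊢u)) (p⊞! d e) = p! (p⊞ (triangle ⊢t d) (triangle ⊢u e))
  triangle (⊢⊞ (⊢Λ ⊢t) (⊢Λ ⊢u)) (p⊞∀ d e) = pΛ (p⊞ (triangle ⊢t d) (triangle ⊢u e))
  triangle _ p•𝟏 = p⋆
  triangle (⊢• (⊢ƛ ⊢t)) (p•⊸ d) = pƛ (p• (triangle ⊢t d))
  triangle (⊢δ⊗ (⊢• ⊢t) ⊢v) (p•⊗ d e) = p• (pδ⊗ (triangle ⊢t d) (triangle ⊢v e))
  triangle _ p•⊤ = p⟨⟩
  triangle (⊢• (⊢⟨,⟩ ⊢t ⊢u)) (p•& d e) = p⟨,⟩ (p• (triangle ⊢t d)) (p• (triangle ⊢u e))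
  triangle (⊢δ⊕ (⊢• ⊢t) ⊢v ⊢w) (p•⊕ d e f) = p• (pδ⊕ (triangle ⊢t d) (triangle ⊢v e) (triangle ⊢w f))
  triangle (⊢• (⊢! ⊢t)) (p•! d) = p! (p• (triangle ⊢t d))
  triangle (⊢• (⊢Λ ⊢t)) (p•∀ d) = pΛ (p• (triangle ⊢t d))

  confluent : Confluent
  confluent {Γ = Γ} {A} ⊢t rs ss =
    map₂ (map×  (⇒⊆⟶* ⋆) (⇒⊆⟶* ⋆))
         (TriangleConfluence.confluent (Γ ⊢_∶ A) _⇒_ develop subject-reduction triangle
                                       ⊢t (map⋆ ⟶⊆⇒ rs) (map⋆ ⟶⊆⇒ ss))

theorem2 : ∀ {c ℓ} (𝒮 : Semiring c ℓ) → let open Calculus 𝒮 in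
    ∀ {n m} {Γ : Ctx n m} {A : Ty n} {t u₁ u₂ : Tm n m} →
    Γ ⊢ t ∶ A → t ⟶* u₁ → t ⟶* u₂ →
    ∃ λ v → (u₁ ⟶* v) × (u₂ ⟶* v)
theorem2 𝒮 = Confluence.confluent 𝒮
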